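{- Let $G$ be a set, $k,\ell\ge1$, $\vec r\in\mathbb Z_{\ge1}^k$, $\vec a\in G^k$, $\vec s\in\mathbb Z_{\ge1}^\ell$, $\vec b\in G^\ell$. Then in $(\mathcal H(\mathbb Z_{\ge1}\times G),\sqcup\!\sqcup_\rho)$, $$\binom{\vec r}{\vec a}\sqcup\!\sqcup_\rho\binom{\vec s}{\vec b}=\sum_{\substack{\sigma\in S(k,\ell)\\ \vec t\in\mathbb Z_{\ge1}^{k+\ell},\ |\vec t|=|\vec r|+|\vec s|}}\Big(\prod_{i=1}^{k+\ell}\binom{t_i-1}{\kappa_{\sigma(i)}-1-\frac12\big(1-\varepsilon_\sigma(i)\varepsilon_\sigma(i-1)\big)\sum_{j=1}^{i-1}(t_j-\kappa_{\sigma(j)})}\Big)\binom{\vec t}{\vec a\sqcup\!\sqcup_\sigma\vec b},$$ with the convention $\varepsilon_\sigma(0)=\varepsilon_\sigma(1)$.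
   Context: Words: $\binom{s_1,\dots,s_m}{b_1,\dots,b_m}$ denotes the word $(s_1,b_1)\cdots(s_m,b_m)$ in the free monoid on $\mathbb Z_{\ge1}\times G$; empty word $1$; $\mathcal H(\mathbb Z_{\ge1}\times G)$ is the free abelian group on these words. Let $x_0$ and $x_b$ ($b\in G$) be pairwise distinct letters (indexed by $\{0\}\sqcup G$), $\sqcup\!\sqcup$ the shuffle product on words in them ($1\sqcup\!\sqcup w=w\sqcup\!\sqcup1=w$, $(a_1u)\sqcup\!\sqcup(b_1v)=a_1(u\sqcup\!\sqcup b_1v)+b_1(a_1u\sqcup\!\sqcup v)$), $\mathcal H_1$ the span of $1$ and words ending in some $x_b$ (basis $1$ and $x_0^{s_1-1}x_{b_1}\cdots x_0^{s_m-1}x_{b_m}$), $\rho$ the linear bijection $x_0^{s_1-1}x_{b_1}\cdots x_0^{s_m-1}x_{b_m}\mapsto\binom{s_1,\dots,s_m}{b_1,\dots,b_m}$, $1\mapsto1$, and $u\sqcup\!\sqcup_\rho v=\rho(\rho^{ -1}u\sqcup\!\sqcup\rho^{ -1}v)$. $|\vec x|$ is the sum of entries. $S(k,\ell)$ is the set of permutations $\sigma$ of $\{1,\dots,k+\ell\}$ with $\sigma^{ -1}(1)<\cdots<\sigma^{ -1}(k)$ and $\sigma^{ -1}(k+1)<\cdots<\sigma^{ -1}(k+\ell)$. $\varepsilon_\sigma(i)=1$ if $1\le\sigma(i)\le k$ and $-1$ if $k+1\le\sigma(i)\le k+\ell$. $\vec\kappa=(r_1,\dots,r_k,s_1,\dots,s_\ell)$,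 $\vec\gamma=(a_1,\dots,a_k,b_1,\dots,b_\ell)$, and $\vec a\sqcup\!\sqcup_\sigma\vec b=(\gamma_{\sigma(1)},\dots,\gamma_{\sigma(k+\ell)})$. For integers $a\ge0$ and $b$, $\binom ab$ is the usual binomial coefficient if $0\le b\le a$ and $0$ otherwise. -}

module Defs where

open import Data.Nat as ℕ using (ℕ; zero; suc; _∸_; _<?_; _≤_)
open import Data.Nat.Combinatorics using (_C_)
open import Data.Integer as ℤ using (ℤ; +_; -[1+_]; 0ℤ; 1ℤ; _/_)
import Data.Fin
open import Data.Fin using (Fin; toℕ)
open import Data.Fin.Properties using (all?)
open import Data.Vec as Vec using (Vec; []; _∷_; lookup; _++_)
open import Data.List as List using (List; []; _∷_; map; concatMap; filter; allFin; upTo; foldr)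
open import Data.Product using (_×_; _,_)
open import Relation.Binary.PropositionalEquality using (_≡_)
open import Relation.Nullary using (Dec; yes; no; ¬_)
open import Relation.Nullary.Decidable using (_→-dec_; _×-dec_)
open import Data.Fin.Properties using () renaming (_≟_ to _≟ᶠ_)
open import Data.Nat.Properties using () renaming (_≟_ to _≟ⁿ_)

data Letter (G : Set) : Set where
  x₀ : Letter G
  x  : G → Letter G

-- The shuffle product of two words, as the list (with multiplicity) of the
-- words occurring in it (all coefficients in the defining recursion are 1).
shuffle : {A : Set} → List A → List A → List (List A)
shuffle [] v = v ∷ []
shuffle (a ∷ u) [] = (a ∷ u) ∷ []
shuffle (a ∷ u) (b ∷ v) =
  map (a ∷_) (shuffle u (b ∷ v)) List.++ map (b ∷_) (shuffle (a ∷ u) v)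

HWord : Set → Set
HWord G = List (ℕ × G)

ρ⁻¹ : {G : Set} → HWord G → List (Letter G)
ρ⁻¹ [] = []
ρ⁻¹ ((s , b) ∷ w) = List.replicate (s ∸ 1) x₀ List.++ (x b ∷ ρ⁻¹ w)

-- ρ : x₀^{s₁-1} x_{b₁} ⋯ x₀^{s_m-1} x_{b_m} ↦ (s₁,b₁)⋯(s_m,b_m), 1 ↦ 1.
-- The accumulator counts the pending x₀'s.  (On words not in H₁, i.e.
-- ending in x₀, trailing x₀'s are dropped; this never occurs below.)
ρ-acc : {G : Set} → ℕ → List (Letter G) → HWord G
ρ-acc n [] = []
ρ-acc n (x₀ ∷ w) = ρ-acc (suc n) w
ρ-acc n (x b ∷ w) = (suc n , b) ∷ ρ-acc 0 w

ρ : {G : Set} → List (Letter G) → HWord G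
ρ = ρ-acc 0

-- The free abelian group H(Z_{≥1} × G): formal Z-linear combinations of
-- words, with equality "same coefficient of every word", expressed by
-- agreement under every Z-valued function on words (extended linearly).

Formal : Set → Set
Formal G = List (ℤ × HWord G)

sumℤ : List ℤ → ℤ
sumℤ = foldr ℤ._+_ 0ℤ

evalF : {G : Set} → (HWord G → ℤ) → Formal G → ℤ
evalF f xs = sumℤ (map (λ { (c , w) → c ℤ.* f w }) xs)

_≈F_ : {G : Set} → Formal G → Formal G → Set
_≈F_ {G} X Y = (f : HWord G → ℤ) → evalF f X ≡ evalF f Y

_⧢ρ_ : {G : Set} → HWord G → HWord G → Formal G
u ⧢ρ v = map (λ w → (1ℤ , ρ w)) (shuffle (ρ⁻¹ u) (ρ⁻¹ v))

allVecs : {A : Set} → List A → (n : ℕ) → List (Vec A n)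
allVecs xs zero = [] ∷ []
allVecs xs (suc n) = concatMap (λ a → map (a ∷_) (allVecs xs n)) xs

IsPerm : {n : ℕ} → Vec (Fin n) n → Set
IsPerm {n} σ = (i j : Fin n) → lookup σ i ≡ lookup σ j → i ≡ j

-- σ⁻¹(1) < ⋯ < σ⁻¹(k) and σ⁻¹(k+1) < ⋯ < σ⁻¹(k+ℓ), i.e. σ is increasing on
-- the positions it sends into {1..k}, and on those sent into {k+1..k+ℓ}.
-- (Indices are 0-based: σ(i) < k means σ(i) ∈ {1..k}.)
SameBlock : (k : ℕ) {n : ℕ} → Fin n → Fin n → Set
SameBlock k p q = (toℕ p ℕ.< k) ⇔′ (toℕ q ℕ.< k)
  where
  _⇔′_ : Set → Set → Set
  A ⇔′ B = (A → B) × (B → A)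

IsShuffleOrder : (k : ℕ) {n : ℕ} → Vec (Fin n) n → Set
IsShuffleOrder k {n} σ = (i j : Fin n) → toℕ i ℕ.< toℕ j →
  SameBlock k (lookup σ i) (lookup σ j) → toℕ (lookup σ i) ℕ.< toℕ (lookup σ j)

InS : (k ℓ : ℕ) → Vec (Fin (k ℕ.+ ℓ)) (k ℕ.+ ℓ) → Set
InS k ℓ σ = IsPerm σ × IsShuffleOrder k σ

InS? : (k ℓ : ℕ) → (σ : Vec (Fin (k ℕ.+ ℓ)) (k ℕ.+ ℓ)) → Dec (InS k ℓ σ)
InS? k ℓ σ =
  (all? λ i → all? λ j → (lookup σ i ≟ᶠ lookup σ j) →-dec (i ≟ᶠ j))
  ×-dec
  (all? λ i → all? λ j → (toℕ i <? toℕ j) →-dec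
     ((((toℕ (lookup σ i) <? k) →-dec (toℕ (lookup σ j) <? k))
       ×-dec ((toℕ (lookup σ j) <? k) →-dec (toℕ (lookup σ i) <? k)))
      →-dec (toℕ (lookup σ i) <? toℕ (lookup σ j))))

S : (k ℓ : ℕ) → List (Vec (Fin (k ℕ.+ ℓ)) (k ℕ.+ ℓ))
S k ℓ = filter (InS? k ℓ) (allVecs (allFin (k ℕ.+ ℓ)) (k ℕ.+ ℓ))

sumℕ : {n : ℕ} → Vec ℕ n → ℕ
sumℕ = Vec.foldr _ ℕ._+_ 0

Comps : (n N : ℕ) → List (Vec ℕ n)
Comps n N = filter (λ t → sumℕ t ≟ⁿ N) (allVecs (map suc (upTo N)) n)

-- binomial coefficient with integer lower index (0 unless 0 ≤ b ≤ a)
binomℤ : ℕ → ℤ → ℕ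
binomℤ a (+ b) = a C b
binomℤ a -[1+ _ ] = 0

-- position i ↦ i-1, with position 0 ↦ 0 (convention ε_σ(0) = ε_σ(1))
prevIdx : {m : ℕ} → Fin m → Fin m
prevIdx Data.Fin.zero = Data.Fin.zero
prevIdx (Data.Fin.suc i) = Data.Fin.inject₁ i

productℕ : List ℕ → ℕ
productℕ = foldr ℕ._*_ 1

module _ (k ℓ : ℕ) (κ : Vec ℕ (k ℕ.+ ℓ)) (σ : Vec (Fin (k ℕ.+ ℓ)) (k ℕ.+ ℓ))
         (t : Vec ℕ (k ℕ.+ ℓ)) where

  private n = k ℕ.+ ℓ

  ε : Fin n → ℤ
  ε i with toℕ (lookup σ i) <? k
  ... | yes _ = 1ℤ
  ... | no _ = ℤ.- 1ℤ

  εprev : Fin n → ℤ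
  εprev i = ε (prevIdx i)

  partial : Fin n → ℤ
  partial i = sumℤ (map (λ j → + lookup t j ℤ.- + lookup κ (lookup σ j))
                        (filter (λ j → toℕ j <? toℕ i) (allFin n)))

  lower : Fin n → ℤ
  lower i = + lookup κ (lookup σ i) ℤ.- 1ℤ
            ℤ.- (((1ℤ ℤ.- ε i ℤ.* εprev i) ℤ.* partial i) / + 2)

  coeff : ℕ
  coeff = productℕ (map (λ i → binomℤ (lookup t i ∸ 1) (lower i)) (allFin n))

RHS : {G : Set} (k ℓ : ℕ) → Vec ℕ k → Vec G k → Vec ℕ ℓ → Vec G ℓ → Formal G
RHS k ℓ r a s b =
  concatMap (λ σ → map (λ t →
      (+ coeff k ℓ κ σ t ,
       Vec.toList (Vec.zipWith _,_ t (Vec.map (lookup γ) σ))))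
    (Comps (k ℕ.+ ℓ) (sumℕ r ℕ.+ sumℕ s)))
    (S k ℓ)
  where
  κ = r ++ s
  γ = a ++ b

word : {G : Set} {m : ℕ} → Vec ℕ m → Vec G m → HWord G
word s b = Vec.toList (Vec.zipWith _,_ s b)

-- Both sides are compared through an arbitrary functional f on words, which is what ≈F means.
-- Splitting off the first letter of a shuffle of x₀^(r-1) x_a A with x₀^(s-1) x_b B gives a
-- recursion: x_a comes first after j of the other word's x₀'s in C(r-1+j, r-1) ways, leaving
-- x₀^(s-1-j) x_b B.  On the right, splitting off the first entry of σ (necessarily 0 or k)
-- generates the same words letter by letter, a letter of weight t and prescribed weight κ
-- carrying C(t-1, κ-1-½(1-εε′)P).  Within a run of letters of one word the surplus P does not
-- enter; at a switch of words it lowers the index by P, which matches the shortening of the other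
-- word's next letter: a surplus j < s is absorbed by it, while j ≥ s gives a vanishing binomial.

module Submission where

open import Defs

open import Data.Bool using (Bool; true; false; T; if_then_else_)
open import Data.Empty using (⊥; ⊥-elim)
open import Data.Fin as Fin using (Fin; zero; suc; toℕ; punchIn; punchOut; fromℕ<)
import Data.Fin.Properties as FinP
open import Data.Integer as ℤ using (ℤ; +_; -[1+_]; 0ℤ; 1ℤ; -1ℤ; _+_; _*_; _-_; -_; _⊖_)
import Data.Integer.Properties as ℤP
open import Data.Integer.Tactic.RingSolver using (solve-∀)
open import Data.List using (List; []; _∷_; _++_; map; concatMap; filter; replicate; upTo; applyUpTo; length; tabulate; allFin)
import Data.List.Properties as ListP
open import Data.List.Relation.Unary.All as ListAll using ([]; _∷_)
open import Data.Maybe using (Maybe; just; nothing)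
open import Data.Maybe.Properties using (just-injective)
open import Data.Nat as ℕ using (ℕ; zero; suc; _∸_; _≤_; _<_; z≤n; s≤s; _≤ᵇ_; _≡ᵇ_; _<?_) renaming (_+_ to _+ℕ_)
open import Data.Nat.Combinatorics using (_C_; nCn≡1; nCk+nC[k+1]≡[n+1]C[k+1]; k>n⇒nCk≡0)
open import Data.Nat.DivMod using (m*n/n≡m)
import Data.Nat.Properties as ℕP
import Data.Nat.Tactic.RingSolver as ℕSolver
open import Data.Product using (_×_; _,_; proj₁; proj₂; ∃)
open import Data.Product.Function.NonDependent.Propositional using (_×-⇔_)
open import Data.Vec as Vec using (Vec; []; _∷_; lookup)
import Data.Vec.Properties as VecP
open import Data.Vec.Relation.Unary.All using (All; []; _∷_)
open import Function using (_∘_)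
open import Function.Bundles using (_⇔_; mk⇔; Equivalence)
open import Relation.Binary using (tri<; tri≈; tri>)
open import Relation.Binary.PropositionalEquality
open import Relation.Nullary using (Dec; yes; no; does; ¬_)
open import Relation.Nullary.Decidable
  using (_→-dec_; _×-dec_; dec-true; dec-false; does-≡) renaming (map to map-dec)

open import Algebra.Properties.CommutativeSemigroup ℤP.+-commutativeSemigroup using (interchange)
open import Algebra.Properties.CommutativeMonoid.Sum ℤP.+-0-commutativeMonoid
  using (sum; sum-remove; sum-cong-≗; sum-replicate-zero)
open import Algebra.Properties.Monoid.Sum ℕP.*-1-monoid using () renaming (sum to product; sum-cong-≗ to product-cong)

private variable
  A B G : Set
  n : ℕ

sumBy : (A → ℤ) → List A → ℤ
sumBy g xs = sumℤ (map g xs)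

sumBy-cong : {g h : A → ℤ} → (∀ u → g u ≡ h u) → (xs : List A) → sumBy g xs ≡ sumBy h xs
sumBy-cong g≗h []       = refl
sumBy-cong g≗h (u ∷ xs) = cong₂ _+_ (g≗h u) (sumBy-cong g≗h xs)

sumBy-zero : (xs : List A) → sumBy {A} (λ _ → 0ℤ) xs ≡ 0ℤ
sumBy-zero []       = refl
sumBy-zero (u ∷ xs) = trans (ℤP.+-identityˡ _) (sumBy-zero xs)

sumBy-vanishes : {g : A → ℤ} → (∀ u → g u ≡ 0ℤ) → (xs : List A) → sumBy g xs ≡ 0ℤ
sumBy-vanishes g≗0 xs = trans (sumBy-cong g≗0 xs) (sumBy-zero xs)

sumBy-++ : (g : A → ℤ) (xs ys : List A) → sumBy g (xs ++ ys) ≡ sumBy g xs + sumBy g ys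
sumBy-++ g []       ys = sym (ℤP.+-identityˡ _)
sumBy-++ g (u ∷ xs) ys = trans (cong (_+_ (g u)) (sumBy-++ g xs ys)) (sym (ℤP.+-assoc (g u) _ _))

sumBy-+ : (g h : A → ℤ) (xs : List A) → sumBy (λ u → g u + h u) xs ≡ sumBy g xs + sumBy h xs
sumBy-+ g h []       = refl
sumBy-+ g h (u ∷ xs) =
  trans (cong (_+_ (g u + h u)) (sumBy-+ g h xs)) (interchange (g u) (h u) (sumBy g xs) (sumBy h xs))

sumBy-*ˡ : (c : ℤ) (g : A → ℤ) (xs : List A) → sumBy (λ u → c * g u) xs ≡ c * sumBy g xs
sumBy-*ˡ c g []       = sym (ℤP.*-zeroʳ c)
sumBy-*ˡ c g (u ∷ xs) =
  trans (cong (_+_ (c * g u)) (sumBy-*ˡ c g xs)) (sym (ℤP.*-distribˡ-+ c (g u) (sumBy g xs)))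

sumBy-map : (g : B → ℤ) (h : A → B) (xs : List A) → sumBy g (map h xs) ≡ sumBy (g ∘ h) xs
sumBy-map g h []       = refl
sumBy-map g h (u ∷ xs) = cong (_+_ (g (h u))) (sumBy-map g h xs)

sumBy-concatMap : (g : B → ℤ) (h : A → List B) (xs : List A) →
                  sumBy g (concatMap h xs) ≡ sumBy (sumBy g ∘ h) xs
sumBy-concatMap g h []       = refl
sumBy-concatMap g h (u ∷ xs) =
  trans (sumBy-++ g (h u) (concatMap h xs)) (cong (_+_ (sumBy g (h u))) (sumBy-concatMap g h xs))

sumBy-swap : (g : A → B → ℤ) (xs : List A) (ys : List B) →
             sumBy (λ u → sumBy (g u) ys) xs ≡ sumBy (λ y → sumBy (λ u → g u y) xs) ys
sumBy-swap g []       ys = sym (sumBy-zero ys)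
sumBy-swap g (u ∷ xs) ys =
  trans (cong (_+_ (sumBy (g u) ys)) (sumBy-swap g xs ys)) (sym (sumBy-+ (g u) _ ys))

when : Bool → ℤ → ℤ
when true  z = z
when false z = 0ℤ

when-zero : ∀ b → when b 0ℤ ≡ 0ℤ
when-zero true  = refl
when-zero false = refl

when-*ʳ : ∀ b c z → when b (c * z) ≡ c * when b z
when-*ʳ true  c z = refl
when-*ʳ false c z = sym (ℤP.*-zeroʳ c)

when-comm : ∀ b b′ z → when b (when b′ z) ≡ when b′ (when b z)
when-comm true  b′    z = refl
when-comm false true  z = refl
when-comm false false z = refl

when-sumBy : (b : Bool) (g : A → ℤ) (xs : List A) → when b (sumBy g xs) ≡ sumBy (when b ∘ g) xs
when-sumBy true  g xs = refl
when-sumBy false g xs = sym (sumBy-zero xs)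

when-≤ᵇ : ∀ {t N} z → t ≤ N → when (t ≤ᵇ N) z ≡ z
when-≤ᵇ {t} {N} z t≤N with t ≤ᵇ N | ℕP.≤⇒≤ᵇ t≤N
... | true | _ = refl

when-≤ᵇ-cong : ∀ {t N y z} → (t ≤ N → y ≡ z) → when (t ≤ᵇ N) y ≡ when (t ≤ᵇ N) z
when-≤ᵇ-cong {t} {N} y≡z with t ≤ᵇ N in eq
... | true  = y≡z (ℕP.≤ᵇ⇒≤ t N (subst T (sym eq) _))
... | false = refl

sumBy-filter : {P : A → Set} (P? : ∀ u → Dec (P u)) (g : A → ℤ) (xs : List A) →
               sumBy g (filter P? xs) ≡ sumBy (λ u → when (does (P? u)) (g u)) xs
sumBy-filter P? g []       = refl
sumBy-filter P? g (u ∷ xs) with does (P? u)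
... | true  = cong (_+_ (g u)) (sumBy-filter P? g xs)
... | false = trans (sumBy-filter P? g xs) (sym (ℤP.+-identityˡ _))

sumRange : (ℕ → ℤ) → ℕ → ℤ
sumRange h zero    = 0ℤ
sumRange h (suc m) = h 0 + sumRange (h ∘ suc) m

sumRange-cong< : ∀ {g h} m → (∀ j → j < m → g j ≡ h j) → sumRange g m ≡ sumRange h m
sumRange-cong< zero    g≗h = refl
sumRange-cong< (suc m) g≗h =
  cong₂ _+_ (g≗h 0 (s≤s z≤n)) (sumRange-cong< m (λ j j<m → g≗h (suc j) (s≤s j<m)))

sumRange-cong : ∀ {g h} → (∀ j → g j ≡ h j) → ∀ m → sumRange g m ≡ sumRange h m
sumRange-cong g≗h m = sumRange-cong< m (λ j _ → g≗h j)

sumRange-+ : ∀ g h m → sumRange (λ j → g j + h j) m ≡ sumRange g m + sumRange h m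
sumRange-+ g h zero    = refl
sumRange-+ g h (suc m) =
  trans (cong (_+_ (g 0 + h 0)) (sumRange-+ (g ∘ suc) (h ∘ suc) m))
        (interchange (g 0) (h 0) (sumRange (g ∘ suc) m) (sumRange (h ∘ suc) m))

sumRange-vanishes : ∀ {h} → (∀ j → h j ≡ 0ℤ) → ∀ m → sumRange h m ≡ 0ℤ
sumRange-vanishes h≗0 zero    = refl
sumRange-vanishes h≗0 (suc m) = cong₂ _+_ (h≗0 0) (sumRange-vanishes (h≗0 ∘ suc) m)

sumRange-truncate : ∀ h w m → w ≤ m → (∀ j → w ≤ j → h j ≡ 0ℤ) → sumRange h m ≡ sumRange h w
sumRange-truncate h zero    m       _         h≗0 = sumRange-vanishes (λ j → h≗0 j z≤n) m
sumRange-truncate h (suc w) (suc m) (s≤s w≤m) h≗0 =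
  cong (_+_ (h 0)) (sumRange-truncate (h ∘ suc) w m w≤m (λ j w≤j → h≗0 (suc j) (s≤s w≤j)))

sumRange-window : ∀ h c w m → c +ℕ w ≤ m →
  (∀ j → j < c → h j ≡ 0ℤ) → (∀ j → c +ℕ w ≤ j → h j ≡ 0ℤ) →
  sumRange h m ≡ sumRange (λ j → h (c +ℕ j)) w
sumRange-window h zero    w m       le       below above = sumRange-truncate h w m le above
sumRange-window h (suc c) w (suc m) (s≤s le) below above =
  trans (cong₂ _+_ (below 0 (s≤s z≤n))
          (sumRange-window (h ∘ suc) c w m le (λ j j<c → below (suc j) (s≤s j<c))
                                              (λ j le′ → above (suc j) (s≤s le′))))
        (ℤP.+-identityˡ _)

sumBy-applyUpTo : (g : ℕ → ℤ) (h : ℕ → ℕ) (m : ℕ) → sumBy g (applyUpTo h m) ≡ sumRange (g ∘ h) m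
sumBy-applyUpTo g h zero    = refl
sumBy-applyUpTo g h (suc m) = cong (_+_ (g (h 0))) (sumBy-applyUpTo g (h ∘ suc) m)

sumBy-tabulate : (g : A → ℤ) (h : Fin n → A) → sumBy g (tabulate h) ≡ sum (g ∘ h)
sumBy-tabulate {n = zero}  g h = refl
sumBy-tabulate {n = suc n} g h = cong (_+_ (g (h zero))) (sumBy-tabulate g (h ∘ suc))

sum-vanishes : {h : Fin n → ℤ} → (∀ i → h i ≡ 0ℤ) → sum h ≡ 0ℤ
sum-vanishes {n} h≗0 = trans (sum-cong-≗ h≗0) (sum-replicate-zero n)

does-⇔ : {P Q : Set} → P ⇔ Q → (p? : Dec P) (q? : Dec Q) → does p? ≡ does q?
does-⇔ P⇔Q p? q? = does-≡ (map-dec P⇔Q p?) q?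

-- The shuffle side

-- ∑_{j ≤ q} C(p+j, p) g(n+p+j+1, q-j): in a shuffle of x₀^p x_a⋯ with x₀^q x_b⋯ where x_a comes
-- first and is preceded by j of the second word's x₀'s, there are C(p+j, p) interleavings of
-- the x₀'s; after n pending x₀'s the first letter is (n+p+j+1, a) and x₀^(q-j) x_b⋯ remains.
weightedSum : (ℕ → ℕ → ℤ) → ℕ → ℕ → ℕ → ℤ
weightedSum g n p q = sumRange (λ j → + ((p +ℕ j) C p) * g (suc (n +ℕ (p +ℕ j))) (q ∸ j)) (suc q)

module _ (g : ℕ → ℕ → ℤ) where

  private
    C-diag : ∀ p → (p +ℕ 0) C p ≡ 1
    C-diag p = trans (cong (_C p) (ℕP.+-identityʳ p)) (nCn≡1 p)

    pascal : ∀ p j → (suc p +ℕ suc j) C suc p ≡ (p +ℕ suc j) C p +ℕ (suc p +ℕ j) C suc p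
    pascal p j = trans (sym (nCk+nC[k+1]≡[n+1]C[k+1] (p +ℕ suc j) p))
                       (cong (λ m → (p +ℕ suc j) C p +ℕ m C suc p) (ℕP.+-suc p j))

    first-term : ∀ n p q → + ((p +ℕ 0) C p) * g (suc (n +ℕ (p +ℕ 0))) q ≡ g (suc (n +ℕ p)) q
    first-term n p q = trans (cong₂ (λ c m → + c * g (suc (n +ℕ m)) q) (C-diag p) (ℕP.+-identityʳ p))
                             (ℤP.*-identityˡ _)

  weightedSum-00 : ∀ n → weightedSum g n 0 0 ≡ g (suc n) 0
  weightedSum-00 n =
    trans (ℤP.+-identityʳ _) (trans (first-term n 0 0) (cong (λ m → g (suc m) 0) (ℕP.+-identityʳ n)))

  weightedSum-0s : ∀ n q → weightedSum g n 0 (suc q) ≡ g (suc n) (suc q) + weightedSum g (suc n) 0 q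
  weightedSum-0s n q =
    cong₂ _+_ (trans (first-term n 0 (suc q)) (cong (λ m → g (suc m) (suc q)) (ℕP.+-identityʳ n)))
    (sumRange-cong (λ j → cong (λ m → + 1 * g (suc m) (q ∸ j)) (ℕP.+-suc n j)) (suc q))

  weightedSum-s0 : ∀ n p → weightedSum g n (suc p) 0 ≡ weightedSum g (suc n) p 0
  weightedSum-s0 n p = cong (_+ 0ℤ) (trans (first-term n (suc p) 0)
    (trans (cong (λ m → g (suc m) 0) (ℕP.+-suc n p)) (sym (first-term (suc n) p 0))))

  weightedSum-ss : ∀ n p q → weightedSum g n (suc p) (suc q) ≡
                   weightedSum g (suc n) p (suc q) + weightedSum g (suc n) (suc p) q
  weightedSum-ss n p q = begin
    t 0 + sumRange (t ∘ suc) (suc q)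
      ≡⟨ cong₂ _+_ head-term (sumRange-cong split (suc q)) ⟩
    tₗ 0 + sumRange (λ j → tₗ (suc j) + tᵣ j) (suc q)
      ≡⟨ cong (_+_ (tₗ 0)) (sumRange-+ (tₗ ∘ suc) tᵣ (suc q)) ⟩
    tₗ 0 + (sumRange (tₗ ∘ suc) (suc q) + sumRange tᵣ (suc q))
      ≡⟨ sym (ℤP.+-assoc (tₗ 0) _ _) ⟩
    weightedSum g (suc n) p (suc q) + weightedSum g (suc n) (suc p) q ∎
    where
    open ≡-Reasoning
    t tₗ tᵣ : ℕ → ℤ
    t  j = + ((suc p +ℕ j) C suc p) * g (suc (n +ℕ (suc p +ℕ j))) (suc q ∸ j)
    tₗ j = + ((p +ℕ j) C p) * g (suc (suc n +ℕ (p +ℕ j))) (suc q ∸ j)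
    tᵣ j = + ((suc p +ℕ j) C suc p) * g (suc (suc n +ℕ (suc p +ℕ j))) (q ∸ j)
    head-term : t 0 ≡ tₗ 0
    head-term = trans (first-term n (suc p) (suc q))
      (trans (cong (λ m → g (suc m) (suc q)) (ℕP.+-suc n p)) (sym (first-term (suc n) p (suc q))))
    split : ∀ j → t (suc j) ≡ tₗ (suc j) + tᵣ j
    split j = begin
      + ((suc p +ℕ suc j) C suc p) * gⱼ
        ≡⟨ cong (_* gⱼ) (trans (cong +_ (pascal p j)) (ℤP.pos-+ ((p +ℕ suc j) C p) ((suc p +ℕ j) C suc p))) ⟩
      (+ ((p +ℕ suc j) C p) + + ((suc p +ℕ j) C suc p)) * gⱼ
        ≡⟨ ℤP.*-distribʳ-+ gⱼ (+ ((p +ℕ suc j) C p)) (+ ((suc p +ℕ j) C suc p)) ⟩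
      + ((p +ℕ suc j) C p) * gⱼ + + ((suc p +ℕ j) C suc p) * gⱼ
        ≡⟨ cong₂ (λ m m′ → + ((p +ℕ suc j) C p) * g (suc m) (q ∸ j) + + ((suc p +ℕ j) C suc p) * g (suc m′) (q ∸ j))
                 (ℕP.+-suc n (p +ℕ suc j)) (trans (cong (λ m → n +ℕ suc m) (ℕP.+-suc p j)) (ℕP.+-suc n (suc (p +ℕ j)))) ⟩
      tₗ (suc j) + tᵣ j ∎
      where
      gⱼ : ℤ
      gⱼ = g (suc (n +ℕ (suc p +ℕ suc j))) (q ∸ j)

ρ-acc-replicate : ∀ n m (w : List (Letter G)) → ρ-acc n (replicate m x₀ ++ w) ≡ ρ-acc (m +ℕ n) w
ρ-acc-replicate n zero    w = refl
ρ-acc-replicate n (suc m) w = trans (ρ-acc-replicate (suc n) m w) (cong (λ k → ρ-acc k w) (ℕP.+-suc m n))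

Positive : HWord G → Set
Positive = ListAll.All (λ p → 1 ≤ proj₁ p)

ρ∘ρ⁻¹ : (U : HWord G) → Positive U → ρ (ρ⁻¹ U) ≡ U
ρ∘ρ⁻¹ []                [] = refl
ρ∘ρ⁻¹ ((suc r , a) ∷ U) (_ ∷ U⁺) =
  trans (ρ-acc-replicate 0 r (x a ∷ ρ⁻¹ U))
        (cong₂ (λ m W → (suc m , a) ∷ W) (ℕP.+-identityʳ r) (ρ∘ρ⁻¹ U U⁺))

shuffle-[]ʳ : (u : List A) → shuffle u [] ≡ u ∷ []
shuffle-[]ʳ []      = refl
shuffle-[]ʳ (c ∷ u) = refl

sumBy-shuffle-∷ : (h : List A → ℤ) (c d : A) (u v : List A) →
  sumBy h (shuffle (c ∷ u) (d ∷ v)) ≡ sumBy (h ∘ (c ∷_)) (shuffle u (d ∷ v)) + sumBy (h ∘ (d ∷_)) (shuffle (c ∷ u) v)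
sumBy-shuffle-∷ h c d u v =
  trans (sumBy-++ h (map (c ∷_) (shuffle u (d ∷ v))) _)
        (cong₂ _+_ (sumBy-map h (c ∷_) (shuffle u (d ∷ v))) (sumBy-map h (d ∷_) (shuffle (c ∷ u) v)))

shuffleSum : (HWord G → ℤ) → HWord G → HWord G → ℤ
shuffleSum f U V = sumBy (f ∘ ρ) (shuffle (ρ⁻¹ U) (ρ⁻¹ V))

shuffleSum-[]ˡ : (f : HWord G → ℤ) (V : HWord G) → Positive V → shuffleSum f [] V ≡ f V
shuffleSum-[]ˡ f V V⁺ = trans (ℤP.+-identityʳ _) (cong f (ρ∘ρ⁻¹ V V⁺))

shuffleSum-[]ʳ : (f : HWord G → ℤ) (U : HWord G) → Positive U → shuffleSum f U [] ≡ f U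
shuffleSum-[]ʳ f U U⁺ =
  trans (cong (sumBy (f ∘ ρ)) (shuffle-[]ʳ (ρ⁻¹ U))) (shuffleSum-[]ˡ f U U⁺)

module _ (f : HWord G → ℤ) (a b : G) (A B : List (Letter G)) where

  Λ : ℕ → ℕ → ℕ → ℤ
  Λ n p q = sumBy (f ∘ ρ-acc n) (shuffle (replicate p x₀ ++ x a ∷ A) (replicate q x₀ ++ x b ∷ B))

  gˡ gʳ : ℕ → ℕ → ℤ
  gˡ m h = sumBy (λ w → f ((m , a) ∷ ρ w)) (shuffle A (replicate h x₀ ++ x b ∷ B))
  gʳ m h = sumBy (λ w → f ((m , b) ∷ ρ w)) (shuffle (replicate h x₀ ++ x a ∷ A) B)

  Λ-firstLetter : ∀ n p q → Λ n p q ≡ weightedSum gˡ n p q + weightedSum gʳ n q p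
  Λ-firstLetter n zero zero =
    trans (sumBy-shuffle-∷ (f ∘ ρ-acc n) (x a) (x b) A B)
          (sym (cong₂ _+_ (weightedSum-00 gˡ n) (weightedSum-00 gʳ n)))
  Λ-firstLetter n zero (suc q) = begin
    Λ n 0 (suc q)
      ≡⟨ sumBy-shuffle-∷ (f ∘ ρ-acc n) (x a) x₀ A (replicate q x₀ ++ x b ∷ B) ⟩
    gˡ (suc n) (suc q) + Λ (suc n) 0 q
      ≡⟨ cong (_+_ (gˡ (suc n) (suc q))) (Λ-firstLetter (suc n) 0 q) ⟩
    gˡ (suc n) (suc q) + (weightedSum gˡ (suc n) 0 q + weightedSum gʳ (suc n) q 0)
      ≡⟨ sym (ℤP.+-assoc (gˡ (suc n) (suc q)) _ _) ⟩
    gˡ (suc n) (suc q) + weightedSum gˡ (suc n) 0 q + weightedSum gʳ (suc n) q 0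
      ≡⟨ cong₂ _+_ (sym (weightedSum-0s gˡ n q)) (sym (weightedSum-s0 gʳ n q)) ⟩
    weightedSum gˡ n 0 (suc q) + weightedSum gʳ n (suc q) 0 ∎
    where open ≡-Reasoning
  Λ-firstLetter n (suc p) zero = begin
    Λ n (suc p) 0
      ≡⟨ sumBy-shuffle-∷ (f ∘ ρ-acc n) x₀ (x b) (replicate p x₀ ++ x a ∷ A) B ⟩
    Λ (suc n) p 0 + gʳ (suc n) (suc p)
      ≡⟨ cong (_+ gʳ (suc n) (suc p)) (Λ-firstLetter (suc n) p 0) ⟩
    weightedSum gˡ (suc n) p 0 + weightedSum gʳ (suc n) 0 p + gʳ (suc n) (suc p)
      ≡⟨ ℤP.+-assoc (weightedSum gˡ (suc n) p 0) _ _ ⟩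
    weightedSum gˡ (suc n) p 0 + (weightedSum gʳ (suc n) 0 p + gʳ (suc n) (suc p))
      ≡⟨ cong (_+_ (weightedSum gˡ (suc n) p 0)) (ℤP.+-comm (weightedSum gʳ (suc n) 0 p) _) ⟩
    weightedSum gˡ (suc n) p 0 + (gʳ (suc n) (suc p) + weightedSum gʳ (suc n) 0 p)
      ≡⟨ cong₂ _+_ (sym (weightedSum-s0 gˡ n p)) (sym (weightedSum-0s gʳ n p)) ⟩
    weightedSum gˡ n (suc p) 0 + weightedSum gʳ n 0 (suc p) ∎
    where open ≡-Reasoning
  Λ-firstLetter n (suc p) (suc q) = begin
    Λ n (suc p) (suc q)
      ≡⟨ sumBy-shuffle-∷ (f ∘ ρ-acc n) x₀ x₀ (replicate p x₀ ++ x a ∷ A) (replicate q x₀ ++ x b ∷ B) ⟩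
    Λ (suc n) p (suc q) + Λ (suc n) (suc p) q
      ≡⟨ cong₂ _+_ (Λ-firstLetter (suc n) p (suc q)) (Λ-firstLetter (suc n) (suc p) q) ⟩
    (a₁ + b₁) + (a₂ + b₂)
      ≡⟨ interchange a₁ b₁ a₂ b₂ ⟩
    (a₁ + a₂) + (b₁ + b₂)
      ≡⟨ cong (_+_ (a₁ + a₂)) (ℤP.+-comm b₁ b₂) ⟩
    (a₁ + a₂) + (b₂ + b₁)
      ≡⟨ cong₂ _+_ (sym (weightedSum-ss gˡ n p q)) (sym (weightedSum-ss gʳ n q p)) ⟩
    weightedSum gˡ n (suc p) (suc q) + weightedSum gʳ n (suc q) (suc p) ∎
    where
    open ≡-Reasoning
    a₁ b₁ a₂ b₂ : ℤ
    a₁ = weightedSum gˡ (suc n) p (suc q)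
    b₁ = weightedSum gʳ (suc n) (suc q) p
    a₂ = weightedSum gˡ (suc n) (suc p) q
    b₂ = weightedSum gʳ (suc n) q (suc p)

shuffleSum-∷ : (f : HWord G → ℤ) (r : ℕ) (a : G) (U : HWord G) (s : ℕ) (b : G) (V : HWord G) →
  shuffleSum f ((suc r , a) ∷ U) ((suc s , b) ∷ V) ≡
    weightedSum (λ m h → shuffleSum (f ∘ ((m , a) ∷_)) U ((suc h , b) ∷ V)) 0 r s
  + weightedSum (λ m h → shuffleSum (f ∘ ((m , b) ∷_)) ((suc h , a) ∷ U) V) 0 s r
shuffleSum-∷ f r a U s b V = Λ-firstLetter f a b (ρ⁻¹ U) (ρ⁻¹ V) 0 r s

pos-∸ : ∀ {m n} → n ≤ m → + m - + n ≡ + (m ∸ n)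
pos-∸ {m} {n} n≤m = trans (ℤP.m-n≡m⊖n m n) (ℤP.⊖-≥ n≤m)

surplus-after : ∀ p {u t} → u ≤ t → + p + (+ t - + u) ≡ + (p +ℕ (t ∸ u))
surplus-after p u≤t = trans (cong (_+_ (+ p)) (pos-∸ u≤t)) (sym (ℤP.pos-+ p _))

-- κ - 1 - ½(1 - ε ε′) P for a letter of prescribed weight κ and sign ε = ε_σ(i) after one of
-- sign ε′ = ε_σ(i-1), where P = ∑_{j<i} (t_j - κ_σ(j)) is the surplus so far.
lowerIndex : ℕ → ℤ → ℤ → ℤ → ℤ
lowerIndex κ ε ε′ P = + κ - 1ℤ - (((1ℤ - ε * ε′) * P) ℤ./ + 2)

lowerIndex-no-surplus : ∀ κ ε ε′ → lowerIndex κ ε ε′ 0ℤ ≡ + κ - 1ℤ - 0ℤ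
lowerIndex-no-surplus κ ε ε′ = cong (λ z → + κ - 1ℤ - (z ℤ./ + 2)) (ℤP.*-zeroʳ (1ℤ - ε * ε′))

lowerIndex-neg : ∀ κ ε ε′ P → lowerIndex κ ε ε′ P ≡ lowerIndex κ (- ε) (- ε′) P
lowerIndex-neg κ ε ε′ P = cong (λ z → + κ - 1ℤ - (((1ℤ - z) * P) ℤ./ + 2)) (*≡neg*neg ε ε′)
  where
  *≡neg*neg : ∀ e e′ → e * e′ ≡ (- e) * (- e′)
  *≡neg*neg = solve-∀

lowerIndex-switch : ∀ κ p → lowerIndex κ -1ℤ 1ℤ (+ p) ≡ + κ - 1ℤ - + p
lowerIndex-switch κ p = cong (λ z → + κ - 1ℤ - z) half
  where
  half : (+ 2 * + p) ℤ./ + 2 ≡ + p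
  half = trans (cong (ℤ._/ + 2) (sym (ℤP.pos-* 2 p)))
               (trans (ℤP.*-identityˡ _) (cong +_ (trans (cong (ℕ._/ 2) (ℕP.*-comm 2 p)) (m*n/n≡m p 2))))

binom-no-surplus : ∀ j r ε ε′ → binomℤ j (lowerIndex (suc r) ε ε′ 0ℤ) ≡ j C r
binom-no-surplus j r ε ε′ = cong (binomℤ j) (trans (lowerIndex-no-surplus (suc r) ε ε′) (ℤP.+-identityʳ (+ r)))

-- Within one word the signs agree and 1 - ε ε′ vanishes.
binom-sameBlock : ∀ j r P → binomℤ j (lowerIndex (suc r) 1ℤ 1ℤ P) ≡ j C r
binom-sameBlock j r P = binom-no-surplus j r 1ℤ 1ℤ

binom-sameBlock-below : ∀ j u P → suc j < u → binomℤ j (lowerIndex u 1ℤ 1ℤ P) ≡ 0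
binom-sameBlock-below j (suc r) P (s≤s j<r) = trans (binom-sameBlock j r P) (k>n⇒nCk≡0 j<r)

binom-negative : ∀ a κ p → κ ≤ p → binomℤ a (+ κ - 1ℤ - + p) ≡ 0
binom-negative a κ p κ≤p = cong (binomℤ a) (begin
  + κ - 1ℤ - + p       ≡⟨ regroup (+ κ) (+ p) ⟩
  + κ - + suc p        ≡⟨ ℤP.m-n≡m⊖n κ (suc p) ⟩
  κ ⊖ suc p            ≡⟨ ℤP.⊖-< (s≤s κ≤p) ⟩
  - + (suc p ∸ κ)      ≡⟨ cong (λ m → - + m) (ℕP.+-∸-assoc 1 κ≤p) ⟩
  -[1+ p ∸ κ ]         ∎)
  where
  open ≡-Reasoning
  regroup : ∀ m n → m - 1ℤ - n ≡ m - (1ℤ + n)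
  regroup = solve-∀

-- The right-hand side, generated letter by letter

weight : HWord G → ℕ
weight []            = 0
weight ((r , _) ∷ U) = r +ℕ weight U

module Expansion (M : ℕ) where

  weights : List ℕ
  weights = map suc (upTo M)

  sumBy-weights : (g : ℕ → ℤ) → sumBy g weights ≡ sumRange (g ∘ suc) M
  sumBy-weights g = trans (sumBy-map g suc (upTo M)) (sumBy-applyUpTo (g ∘ suc) (λ j → j) M)

  sumBy-weights-cong : ∀ {g h} → (∀ j → g (suc j) ≡ h (suc j)) → sumBy g weights ≡ sumBy h weights
  sumBy-weights-cong {g} {h} g≗h =
    trans (sumBy-map g suc (upTo M)) (trans (sumBy-cong g≗h (upTo M)) (sym (sumBy-map h suc (upTo M))))

  sumBy-weights-vanishes : ∀ {g} → (∀ j → g (suc j) ≡ 0ℤ) → sumBy g weights ≡ 0ℤ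
  sumBy-weights-vanishes {g} g≗0 = trans (sumBy-map g suc (upTo M)) (sumBy-vanishes g≗0 (upTo M))

  -- expand f U V P ε N is the right-hand side for the words U, V still to be merged, seen by f
  -- after the letters produced so far: P is their surplus ∑ (t_j - κ_σ(j)), ε the sign of the
  -- last of them, and N the weight still to be distributed.  Letters of U have sign 1, of V -1.
  mutual
    expand : (HWord G → ℤ) → HWord G → HWord G → ℤ → ℤ → ℕ → ℤ
    expand f []            []            P ε N = when (N ≡ᵇ 0) (f [])
    expand f ((r , a) ∷ U) []            P ε N = expandˡ f r a U [] P ε N
    expand f []            ((s , b) ∷ V) P ε N = expandʳ f [] s b V P ε N
    expand f ((r , a) ∷ U) ((s , b) ∷ V) P ε N =
      expandˡ f r a U ((s , b) ∷ V) P ε N + expandʳ f ((r , a) ∷ U) s b V P ε N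

    expandˡ : (HWord G → ℤ) → ℕ → G → HWord G → HWord G → ℤ → ℤ → ℕ → ℤ
    expandˡ f r a U V P ε N = sumBy (termˡ f r a U V P ε N) weights

    expandʳ : (HWord G → ℤ) → HWord G → ℕ → G → HWord G → ℤ → ℤ → ℕ → ℤ
    expandʳ f U s b V P ε N = sumBy (termʳ f U s b V P ε N) weights

    termˡ : (HWord G → ℤ) → ℕ → G → HWord G → HWord G → ℤ → ℤ → ℕ → ℕ → ℤ
    termˡ f r a U V P ε N t = when (t ≤ᵇ N) (+ binomℤ (t ∸ 1) (lowerIndex r 1ℤ ε P) * restˡ f r a U V P N t)

    termʳ : (HWord G → ℤ) → HWord G → ℕ → G → HWord G → ℤ → ℤ → ℕ → ℕ → ℤ
    termʳ f U s b V P ε N t = when (t ≤ᵇ N) (+ binomℤ (t ∸ 1) (lowerIndex s -1ℤ ε P) * restʳ f U s b V P N t)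

    restˡ : (HWord G → ℤ) → ℕ → G → HWord G → HWord G → ℤ → ℕ → ℕ → ℤ
    restˡ f r a U V P N t = expand (f ∘ ((t , a) ∷_)) U V (P + (+ t - + r)) 1ℤ (N ∸ t)

    restʳ : (HWord G → ℤ) → HWord G → ℕ → G → HWord G → ℤ → ℕ → ℕ → ℤ
    restʳ f U s b V P N t = expand (f ∘ ((t , b) ∷_)) U V (P + (+ t - + s)) -1ℤ (N ∸ t)

  mutual
    expand-swap : ∀ f (U V : HWord G) P ε N → expand f U V P ε N ≡ expand f V U P (- ε) N
    expand-swap f []            []            P ε N = refl
    expand-swap f ((r , a) ∷ U) []            P ε N = expandˡ-swap f r a U [] P ε N
    expand-swap f []            ((s , b) ∷ V) P ε N = expandʳ-swap f [] s b V P ε N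
    expand-swap f ((r , a) ∷ U) ((s , b) ∷ V) P ε N =
      trans (cong₂ _+_ (expandˡ-swap f r a U ((s , b) ∷ V) P ε N) (expandʳ-swap f ((r , a) ∷ U) s b V P ε N))
            (ℤP.+-comm (expandʳ f ((s , b) ∷ V) r a U P (- ε) N) _)

    expandˡ-swap : ∀ f r (a : G) U V P ε N → expandˡ f r a U V P ε N ≡ expandʳ f V r a U P (- ε) N
    expandˡ-swap f r a U V P ε N = sumBy-weights-cong λ j → cong (when (suc j ≤ᵇ N))
      (cong₂ _*_ (cong (λ z → + binomℤ j z) (lowerIndex-neg r 1ℤ ε P))
                 (expand-swap (f ∘ ((suc j , a) ∷_)) U V (P + (+ suc j - + r)) 1ℤ (N ∸ suc j)))

    expandʳ-swap : ∀ f U s (b : G) V P ε N → expandʳ f U s b V P ε N ≡ expandˡ f s b V U P (- ε) N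
    expandʳ-swap f U s b V P ε N = sumBy-weights-cong λ j → cong (when (suc j ≤ᵇ N))
      (cong₂ _*_ (cong (λ z → + binomℤ j z) (lowerIndex-neg s -1ℤ ε P))
                 (expand-swap (f ∘ ((suc j , b) ∷_)) U V (P + (+ suc j - + s)) -1ℤ (N ∸ suc j)))

  expandˡ-no-surplus : ∀ f r (a : G) U V ε ε′ N → expandˡ f r a U V 0ℤ ε N ≡ expandˡ f r a U V 0ℤ ε′ N
  expandˡ-no-surplus f r a U V ε ε′ N = sumBy-cong (λ t → cong
    (λ z → when (t ≤ᵇ N) (+ binomℤ (t ∸ 1) z * restˡ f r a U V 0ℤ N t))
    (trans (lowerIndex-no-surplus r 1ℤ ε) (sym (lowerIndex-no-surplus r 1ℤ ε′)))) weights

  expandʳ-no-surplus : ∀ f U s (b : G) V ε ε′ N → expandʳ f U s b V 0ℤ ε N ≡ expandʳ f U s b V 0ℤ ε′ N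
  expandʳ-no-surplus f U s b V ε ε′ N = sumBy-cong (λ t → cong
    (λ z → when (t ≤ᵇ N) (+ binomℤ (t ∸ 1) z * restʳ f U s b V 0ℤ N t))
    (trans (lowerIndex-no-surplus s -1ℤ ε) (sym (lowerIndex-no-surplus s -1ℤ ε′)))) weights

  expand-no-surplus : ∀ f (U V : HWord G) ε ε′ N → expand f U V 0ℤ ε N ≡ expand f U V 0ℤ ε′ N
  expand-no-surplus f []            []            ε ε′ N = refl
  expand-no-surplus f ((r , a) ∷ U) []            ε ε′ N = expandˡ-no-surplus f r a U [] ε ε′ N
  expand-no-surplus f []            ((s , b) ∷ V) ε ε′ N = expandʳ-no-surplus f [] s b V ε ε′ N
  expand-no-surplus f ((r , a) ∷ U) ((s , b) ∷ V) ε ε′ N =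
    cong₂ _+_ (expandˡ-no-surplus f r a U ((s , b) ∷ V) ε ε′ N) (expandʳ-no-surplus f ((r , a) ∷ U) s b V ε ε′ N)

  -- In a run of letters of U the surplus does not enter the binomial, which kills all t < u.
  expandˡ-cong≥ : ∀ f u (a : G) U V V′ P P′ N →
    (∀ t → u ≤ t → t ≤ N → restˡ f u a U V P N t ≡ restˡ f u a U V′ P′ N t) →
    expandˡ f u a U V P 1ℤ N ≡ expandˡ f u a U V′ P′ 1ℤ N
  expandˡ-cong≥ f u a U V V′ P P′ N same = sumBy-weights-cong term
    where
    term : ∀ j → termˡ f u a U V P 1ℤ N (suc j) ≡ termˡ f u a U V′ P′ 1ℤ N (suc j)
    term j with suc j <? u
    ... | yes j<u =
      trans (cong (λ c → when (suc j ≤ᵇ N) (+ c * restˡ f u a U V P N (suc j))) (binom-sameBlock-below j u P j<u))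
            (cong (λ c → when (suc j ≤ᵇ N) (+ c * restˡ f u a U V′ P′ N (suc j))) (sym (binom-sameBlock-below j u P′ j<u)))
    ... | no j≮u = when-≤ᵇ-cong (λ t≤N →
      cong (_*_ (+ binomℤ j (lowerIndex u 1ℤ 1ℤ P))) (same (suc j) (ℕP.≮⇒≥ j≮u) t≤N))

  expandˡ-vanish≥ : ∀ f u (a : G) U V P N →
    (∀ t → u ≤ t → t ≤ N → restˡ f u a U V P N t ≡ 0ℤ) → expandˡ f u a U V P 1ℤ N ≡ 0ℤ
  expandˡ-vanish≥ f u a U V P N vanish = sumBy-weights-vanishes term
    where
    term : ∀ j → termˡ f u a U V P 1ℤ N (suc j) ≡ 0ℤ
    term j with suc j <? u
    ... | yes j<u =
      trans (cong (λ c → when (suc j ≤ᵇ N) (+ c * restˡ f u a U V P N (suc j))) (binom-sameBlock-below j u P j<u))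
            (when-zero (suc j ≤ᵇ N))
    ... | no j≮u = trans (when-≤ᵇ-cong (λ t≤N →
      trans (cong (_*_ (+ binomℤ j (lowerIndex u 1ℤ 1ℤ P))) (vanish (suc j) (ℕP.≮⇒≥ j≮u) t≤N))
            (ℤP.*-zeroʳ (+ binomℤ j (lowerIndex u 1ℤ 1ℤ P)))))
      (when-zero (suc j ≤ᵇ N))

  restˡ-surplus : ∀ f u (a : G) U V p N {t} → u ≤ t →
    restˡ f u a U V (+ p) N t ≡ expand (f ∘ ((t , a) ∷_)) U V (+ (p +ℕ (t ∸ u))) 1ℤ (N ∸ t)
  restˡ-surplus f u a U V p N {t} u≤t =
    cong (λ P → expand (f ∘ ((t , a) ∷_)) U V P 1ℤ (N ∸ t)) (surplus-after p u≤t)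

  expandʳ-absorb : ∀ f U v (b : G) V p N → p < v →
    expandʳ f U v b V (+ p) 1ℤ N ≡ expandʳ f U (v ∸ p) b V 0ℤ 1ℤ N
  expandʳ-absorb f U v b V p N p<v = sumBy-cong (λ t → cong (when (t ≤ᵇ N))
      (cong₂ (λ z P → + binomℤ (t ∸ 1) z * expand (f ∘ ((t , b) ∷_)) U V P -1ℤ (N ∸ t)) lowered (surplus t)))
    weights
    where
    open ≡-Reasoning
    v-p : + v - + p ≡ + (v ∸ p)
    v-p = pos-∸ (ℕP.<⇒≤ p<v)
    regroup : ∀ m n → m - 1ℤ - n ≡ (m - n) - 1ℤ - 0ℤ
    regroup = solve-∀
    regroup′ : ∀ p t v → p + (t - v) ≡ 0ℤ + (t - (v - p))
    regroup′ = solve-∀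
    lowered : lowerIndex v -1ℤ 1ℤ (+ p) ≡ lowerIndex (v ∸ p) -1ℤ 1ℤ 0ℤ
    lowered = begin
      lowerIndex v -1ℤ 1ℤ (+ p)     ≡⟨ lowerIndex-switch v p ⟩
      + v - 1ℤ - + p                ≡⟨ regroup (+ v) (+ p) ⟩
      (+ v - + p) - 1ℤ - 0ℤ         ≡⟨ cong (λ z → z - 1ℤ - 0ℤ) v-p ⟩
      + (v ∸ p) - 1ℤ - 0ℤ           ≡⟨ sym (lowerIndex-no-surplus (v ∸ p) -1ℤ 1ℤ) ⟩
      lowerIndex (v ∸ p) -1ℤ 1ℤ 0ℤ  ∎
    surplus : ∀ t → + p + (+ t - + v) ≡ 0ℤ + (+ t - + (v ∸ p))
    surplus t = trans (regroup′ (+ p) (+ t) (+ v)) (cong (λ z → 0ℤ + (+ t - z)) v-p)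

  expandʳ-absorb-vanish : ∀ f U v (b : G) V p N → v ≤ p → expandʳ f U v b V (+ p) 1ℤ N ≡ 0ℤ
  expandʳ-absorb-vanish f U v b V p N v≤p = sumBy-vanishes (λ t →
      trans (cong (λ c → when (t ≤ᵇ N) (+ c * restʳ f U v b V (+ p) N t))
                  (trans (cong (binomℤ (t ∸ 1)) (lowerIndex-switch v p)) (binom-negative (t ∸ 1) v p v≤p)))
            (when-zero (t ≤ᵇ N)))
    weights

  mutual
    -- The surplus p left by a run of letters of U is paid by the next letter of V.
    expand-absorb : ∀ U f v (b : G) V p N → p < v →
      expand f U ((v , b) ∷ V) (+ p) 1ℤ N ≡ expand f U ((v ∸ p , b) ∷ V) 0ℤ 1ℤ N
    expand-absorb []            f v b V p N p<v = expandʳ-absorb f [] v b V p N p<v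
    expand-absorb ((u , a) ∷ U) f v b V p N p<v = cong₂ _+_
      (expandˡ-cong≥ f u a U ((v , b) ∷ V) ((v ∸ p , b) ∷ V) (+ p) 0ℤ N λ t u≤t _ →
         trans (restˡ-surplus f u a U ((v , b) ∷ V) p N u≤t)
        (trans (expand-absorb-shift U (f ∘ ((t , a) ∷_)) v b V p (t ∸ u) (N ∸ t) p<v)
               (sym (restˡ-surplus f u a U ((v ∸ p , b) ∷ V) 0 N u≤t))))
      (expandʳ-absorb f ((u , a) ∷ U) v b V p N p<v)

    expand-absorb-vanish : ∀ U f v (b : G) V p N → v ≤ p → expand f U ((v , b) ∷ V) (+ p) 1ℤ N ≡ 0ℤ
    expand-absorb-vanish []            f v b V p N v≤p = expandʳ-absorb-vanish f [] v b V p N v≤p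
    expand-absorb-vanish ((u , a) ∷ U) f v b V p N v≤p = cong₂ _+_
      (expandˡ-vanish≥ f u a U ((v , b) ∷ V) (+ p) N λ t u≤t _ →
         trans (restˡ-surplus f u a U ((v , b) ∷ V) p N u≤t)
               (expand-absorb-vanish U (f ∘ ((t , a) ∷_)) v b V (p +ℕ (t ∸ u)) (N ∸ t)
                                     (ℕP.≤-trans v≤p (ℕP.m≤m+n p (t ∸ u)))))
      (expandʳ-absorb-vanish f ((u , a) ∷ U) v b V p N v≤p)

    expand-absorb-shift : ∀ U f v (b : G) V p d N → p < v →
      expand f U ((v , b) ∷ V) (+ (p +ℕ d)) 1ℤ N ≡ expand f U ((v ∸ p , b) ∷ V) (+ d) 1ℤ N
    expand-absorb-shift U f v b V p d N p<v with p +ℕ d <? v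
    ... | yes p+d<v = begin
      expand f U ((v , b) ∷ V) (+ (p +ℕ d)) 1ℤ N  ≡⟨ expand-absorb U f v b V (p +ℕ d) N p+d<v ⟩
      expand f U ((v ∸ (p +ℕ d) , b) ∷ V) 0ℤ 1ℤ N ≡⟨ cong (λ w → expand f U ((w , b) ∷ V) 0ℤ 1ℤ N)
                                                        (sym (ℕP.∸-+-assoc v p d)) ⟩
      expand f U ((v ∸ p ∸ d , b) ∷ V) 0ℤ 1ℤ N    ≡⟨ sym (expand-absorb U f (v ∸ p) b V d N d<v-p) ⟩
      expand f U ((v ∸ p , b) ∷ V) (+ d) 1ℤ N     ∎
      where
      open ≡-Reasoning
      d<v-p : d < v ∸ p
      d<v-p = ℕP.m+n≤o⇒m≤o∸n (suc d) (subst (_≤ v) (cong suc (ℕP.+-comm p d)) p+d<v)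
    ... | no p+d≮v =
      trans (expand-absorb-vanish U f v b V (p +ℕ d) N (ℕP.≮⇒≥ p+d≮v))
            (sym (expand-absorb-vanish U f (v ∸ p) b V d N (ℕP.m≤n+o⇒m∸n≤o v p (ℕP.≮⇒≥ p+d≮v))))

  private
    remaining-short : ∀ {s t N w} → s ≤ t → t ≤ N → N < s +ℕ w → N ∸ t < w
    remaining-short {s} {t} {N} {w} s≤t t≤N N<s+w = subst (N ∸ t <_) (ℕP.m+n∸m≡n t w)
      (ℕP.∸-monoˡ-< (ℕP.<-≤-trans N<s+w (ℕP.+-monoˡ-≤ w s≤t)) t≤N)

  expand-short : ∀ f (U : HWord G) P N → N < weight U → expand f U [] P 1ℤ N ≡ 0ℤ
  expand-short f ((s , b) ∷ U) P N N<w = expandˡ-vanish≥ f s b U [] P N λ t s≤t t≤N →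
    expand-short (f ∘ ((t , b) ∷_)) U (P + (+ t - + s)) (N ∸ t) (remaining-short s≤t t≤N N<w)

  expand-single : ∀ f (U : HWord G) P → Positive U → weight U ≤ M → expand f U [] P 1ℤ (weight U) ≡ f U
  expand-single f []                P []       _   = refl
  expand-single f ((suc s , b) ∷ U) P (_ ∷ U⁺) w≤M = begin
    sumBy term weights                    ≡⟨ sumBy-weights term ⟩
    sumRange (term ∘ suc) M               ≡⟨ sumRange-window (term ∘ suc) s 1 M s+1≤M below above ⟩
    term (suc (s +ℕ 0)) + 0ℤ              ≡⟨ ℤP.+-identityʳ _ ⟩
    term (suc (s +ℕ 0))                   ≡⟨ cong (term ∘ suc) (ℕP.+-identityʳ s) ⟩
    term (suc s)                          ≡⟨ when-≤ᵇ _ (ℕP.m≤m+n (suc s) (weight U)) ⟩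
    + binomℤ s (lowerIndex (suc s) 1ℤ 1ℤ P) * restˡ f (suc s) b U [] P N (suc s)
      ≡⟨ cong₂ (λ c w → + c * expand (f ∘ ((suc s , b) ∷_)) U [] P′ 1ℤ w)
               (trans (binom-sameBlock s s P) (nCn≡1 s)) (ℕP.m+n∸m≡n (suc s) (weight U)) ⟩
    + 1 * expand (f ∘ ((suc s , b) ∷_)) U [] P′ 1ℤ (weight U)
      ≡⟨ ℤP.*-identityˡ _ ⟩
    expand (f ∘ ((suc s , b) ∷_)) U [] P′ 1ℤ (weight U)
      ≡⟨ expand-single (f ∘ ((suc s , b) ∷_)) U P′ U⁺ (ℕP.≤-trans (ℕP.m≤n+m (weight U) (suc s)) w≤M) ⟩
    f ((suc s , b) ∷ U) ∎
    where
    open ≡-Reasoning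
    N : ℕ
    N = suc s +ℕ weight U
    P′ : ℤ
    P′ = P + (+ suc s - + suc s)
    term : ℕ → ℤ
    term = termˡ f (suc s) b U [] P 1ℤ N
    s+1≤M : s +ℕ 1 ≤ M
    s+1≤M = ℕP.≤-trans (ℕP.≤-reflexive (ℕP.+-comm s 1)) (ℕP.≤-trans (ℕP.m≤m+n (suc s) (weight U)) w≤M)
    below : ∀ j → j < s → term (suc j) ≡ 0ℤ
    below j j<s = trans
      (cong (λ c → when (suc j ≤ᵇ N) (+ c * restˡ f (suc s) b U [] P N (suc j)))
            (trans (binom-sameBlock j s P) (k>n⇒nCk≡0 j<s)))
      (when-zero (suc j ≤ᵇ N))
    above : ∀ j → s +ℕ 1 ≤ j → term (suc j) ≡ 0ℤ
    above j s+1≤j = trans (when-≤ᵇ-cong λ t≤N →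
        trans (cong (_*_ (+ binomℤ j (lowerIndex (suc s) 1ℤ 1ℤ P)))
                    (expand-short (f ∘ ((suc j , b) ∷_)) U _ (N ∸ suc j)
                       (remaining-short (s≤s (subst (_≤ j) (ℕP.+-comm s 1) s+1≤j)) t≤N (ℕP.n<1+n N))))
              (ℤP.*-zeroʳ (+ binomℤ j (lowerIndex (suc s) 1ℤ 1ℤ P))))
      (when-zero (suc j ≤ᵇ N))

  private
    remainder-after : ∀ r A s B j → j ≤ s →
      (suc r +ℕ A) +ℕ (suc s +ℕ B) ∸ suc (r +ℕ j) ≡ A +ℕ (suc (s ∸ j) +ℕ B)
    remainder-after r A s B j j≤s = begin
      (suc r +ℕ A) +ℕ (suc s +ℕ B) ∸ suc (r +ℕ j)
        ≡⟨ cong (λ s′ → (suc r +ℕ A) +ℕ (suc s′ +ℕ B) ∸ suc (r +ℕ j)) (sym (ℕP.m+[n∸m]≡n j≤s)) ⟩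
      (suc r +ℕ A) +ℕ (suc (j +ℕ (s ∸ j)) +ℕ B) ∸ suc (r +ℕ j)
        ≡⟨ cong (_∸ suc (r +ℕ j)) (regroup r A j (s ∸ j) B) ⟩
      suc (r +ℕ j) +ℕ (A +ℕ (suc (s ∸ j) +ℕ B)) ∸ suc (r +ℕ j)
        ≡⟨ ℕP.m+n∸m≡n (suc (r +ℕ j)) _ ⟩
      A +ℕ (suc (s ∸ j) +ℕ B) ∎
      where
      open ≡-Reasoning
      regroup : ∀ r A j d B → (suc r +ℕ A) +ℕ (suc (j +ℕ d) +ℕ B) ≡ suc (r +ℕ j) +ℕ (A +ℕ (suc d +ℕ B))
      regroup = ℕSolver.solve-∀

  -- A first letter (r + 1 + j, a) leaves the surplus j, which the first letter of V absorbs.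
  termˡ-firstLetter : ∀ f r (a : G) U s b V ε A B j → j ≤ s →
    termˡ f (suc r) a U ((suc s , b) ∷ V) 0ℤ ε ((suc r +ℕ A) +ℕ (suc s +ℕ B)) (suc (r +ℕ j)) ≡
    + ((r +ℕ j) C r) * expand (f ∘ ((suc (r +ℕ j) , a) ∷_)) U ((suc (s ∸ j) , b) ∷ V) 0ℤ 1ℤ (A +ℕ (suc (s ∸ j) +ℕ B))
  termˡ-firstLetter f r a U s b V ε A B j j≤s = begin
    termˡ f (suc r) a U V′ 0ℤ ε N (suc (r +ℕ j))
      ≡⟨ when-≤ᵇ _ t≤N ⟩
    + binomℤ (r +ℕ j) (lowerIndex (suc r) 1ℤ ε 0ℤ) * restˡ f (suc r) a U V′ 0ℤ N (suc (r +ℕ j))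
      ≡⟨ cong₂ (λ c z → + c * z) (binom-no-surplus (r +ℕ j) r 1ℤ ε)
               (restˡ-surplus f (suc r) a U V′ 0 N (s≤s (ℕP.m≤m+n r j))) ⟩
    + ((r +ℕ j) C r) * expand f′ U V′ (+ (r +ℕ j ∸ r)) 1ℤ (N ∸ suc (r +ℕ j))
      ≡⟨ cong (λ p → + ((r +ℕ j) C r) * expand f′ U V′ (+ p) 1ℤ (N ∸ suc (r +ℕ j))) (ℕP.m+n∸m≡n r j) ⟩
    + ((r +ℕ j) C r) * expand f′ U V′ (+ j) 1ℤ (N ∸ suc (r +ℕ j))
      ≡⟨ cong (_*_ (+ ((r +ℕ j) C r))) (expand-absorb U f′ (suc s) b V j (N ∸ suc (r +ℕ j)) (s≤s j≤s)) ⟩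
    + ((r +ℕ j) C r) * expand f′ U ((suc s ∸ j , b) ∷ V) 0ℤ 1ℤ (N ∸ suc (r +ℕ j))
      ≡⟨ cong₂ (λ v w → + ((r +ℕ j) C r) * expand f′ U ((v , b) ∷ V) 0ℤ 1ℤ w)
               (ℕP.+-∸-assoc 1 j≤s) (remainder-after r A s B j j≤s) ⟩
    + ((r +ℕ j) C r) * expand f′ U ((suc (s ∸ j) , b) ∷ V) 0ℤ 1ℤ (A +ℕ (suc (s ∸ j) +ℕ B)) ∎
    where
    open ≡-Reasoning
    N : ℕ
    N = (suc r +ℕ A) +ℕ (suc s +ℕ B)
    V′ : HWord _
    V′ = (suc s , b) ∷ V
    f′ : HWord _ → ℤ
    f′ = f ∘ ((suc (r +ℕ j) , a) ∷_)
    t≤N : suc (r +ℕ j) ≤ N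
    t≤N = ℕP.≤-trans (s≤s (ℕP.+-monoʳ-≤ r (ℕP.m≤n⇒m≤1+n j≤s)))
                     (ℕP.+-mono-≤ (ℕP.m≤m+n (suc r) A) (ℕP.m≤m+n (suc s) B))

  expandˡ-firstLetter : ∀ f r (a : G) U s b V ε A B (Φ : ℕ → ℕ → ℤ) →
    (suc r +ℕ A) +ℕ (suc s +ℕ B) ≤ M →
    (∀ j → j ≤ s → A +ℕ (suc (s ∸ j) +ℕ B) ≤ M →
       expand (f ∘ ((suc (r +ℕ j) , a) ∷_)) U ((suc (s ∸ j) , b) ∷ V) 0ℤ 1ℤ (A +ℕ (suc (s ∸ j) +ℕ B))
       ≡ Φ (suc (r +ℕ j)) (s ∸ j)) →
    expandˡ f (suc r) a U ((suc s , b) ∷ V) 0ℤ ε ((suc r +ℕ A) +ℕ (suc s +ℕ B)) ≡ weightedSum Φ 0 r s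
  expandˡ-firstLetter f r a U s b V ε A B Φ N≤M rest≡Φ = begin
    sumBy term weights                            ≡⟨ sumBy-weights term ⟩
    sumRange (term ∘ suc) M                       ≡⟨ sumRange-window (term ∘ suc) r (suc s) M r+s+1≤M below above ⟩
    sumRange (λ j → term (suc (r +ℕ j))) (suc s)  ≡⟨ sumRange-cong< (suc s) middle ⟩
    weightedSum Φ 0 r s                           ∎
    where
    open ≡-Reasoning
    N : ℕ
    N = (suc r +ℕ A) +ℕ (suc s +ℕ B)
    V′ : HWord _
    V′ = (suc s , b) ∷ V
    term : ℕ → ℤ
    term = termˡ f (suc r) a U V′ 0ℤ ε N
    r+s+1≤M : r +ℕ suc s ≤ M
    r+s+1≤M = ℕP.≤-trans (ℕP.n≤1+n _)
      (ℕP.≤-trans (ℕP.+-mono-≤ (ℕP.m≤m+n (suc r) A) (ℕP.m≤m+n (suc s) B)) N≤M)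
    below : ∀ j → j < r → term (suc j) ≡ 0ℤ
    below j j<r = trans
      (cong (λ c → when (suc j ≤ᵇ N) (+ c * restˡ f (suc r) a U V′ 0ℤ N (suc j)))
            (trans (binom-no-surplus j r 1ℤ ε) (k>n⇒nCk≡0 j<r)))
      (when-zero (suc j ≤ᵇ N))
    above : ∀ j → r +ℕ suc s ≤ j → term (suc j) ≡ 0ℤ
    above j r+s+1≤j = trans (cong (λ z → when (suc j ≤ᵇ N) (+ binomℤ j (lowerIndex (suc r) 1ℤ ε 0ℤ) * z))
        (trans (restˡ-surplus f (suc r) a U V′ 0 N (s≤s (ℕP.≤-trans (ℕP.m≤m+n r (suc s)) r+s+1≤j)))
               (expand-absorb-vanish U (f ∘ ((suc j , a) ∷_)) (suc s) b V (j ∸ r) (N ∸ suc j)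
                  (ℕP.m+n≤o⇒m≤o∸n (suc s) (subst (_≤ j) (ℕP.+-comm r (suc s)) r+s+1≤j)))))
      (trans (cong (when (suc j ≤ᵇ N)) (ℤP.*-zeroʳ (+ binomℤ j (lowerIndex (suc r) 1ℤ ε 0ℤ))))
             (when-zero (suc j ≤ᵇ N)))
    middle : ∀ j → j < suc s → term (suc (r +ℕ j)) ≡ + ((r +ℕ j) C r) * Φ (suc (r +ℕ j)) (s ∸ j)
    middle j (s≤s j≤s) = trans (termˡ-firstLetter f r a U s b V ε A B j j≤s)
      (cong (_*_ (+ ((r +ℕ j) C r))) (rest≡Φ j j≤s
        (subst (_≤ M) (remainder-after r A s B j j≤s) (ℕP.≤-trans (ℕP.m∸n≤m N (suc (r +ℕ j))) N≤M))))

  expandʳ-firstLetter : ∀ f r (a : G) U s b V ε A B (Φ : ℕ → ℕ → ℤ) →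
    (suc r +ℕ A) +ℕ (suc s +ℕ B) ≤ M →
    (∀ j → j ≤ r → (suc (r ∸ j) +ℕ A) +ℕ B ≤ M →
       expand (f ∘ ((suc (s +ℕ j) , b) ∷_)) ((suc (r ∸ j) , a) ∷ U) V 0ℤ -1ℤ ((suc (r ∸ j) +ℕ A) +ℕ B)
       ≡ Φ (suc (s +ℕ j)) (r ∸ j)) →
    expandʳ f ((suc r , a) ∷ U) (suc s) b V 0ℤ ε ((suc r +ℕ A) +ℕ (suc s +ℕ B)) ≡ weightedSum Φ 0 s r
  expandʳ-firstLetter f r a U s b V ε A B Φ N≤M rest≡Φ = begin
    expandʳ f ((suc r , a) ∷ U) (suc s) b V 0ℤ ε ((suc r +ℕ A) +ℕ (suc s +ℕ B))
      ≡⟨ expandʳ-swap f ((suc r , a) ∷ U) (suc s) b V 0ℤ ε _ ⟩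
    expandˡ f (suc s) b V ((suc r , a) ∷ U) 0ℤ (- ε) ((suc r +ℕ A) +ℕ (suc s +ℕ B))
      ≡⟨ cong (expandˡ f (suc s) b V ((suc r , a) ∷ U) 0ℤ (- ε)) (ℕP.+-comm (suc r +ℕ A) _) ⟩
    expandˡ f (suc s) b V ((suc r , a) ∷ U) 0ℤ (- ε) ((suc s +ℕ B) +ℕ (suc r +ℕ A))
      ≡⟨ expandˡ-firstLetter f s b V r a U (- ε) B A Φ (subst (_≤ M) (ℕP.+-comm (suc r +ℕ A) _) N≤M) swapped ⟩
    weightedSum Φ 0 s r ∎
    where
    open ≡-Reasoning
    swapped : ∀ j → j ≤ r → B +ℕ (suc (r ∸ j) +ℕ A) ≤ M →
      expand (f ∘ ((suc (s +ℕ j) , b) ∷_)) V ((suc (r ∸ j) , a) ∷ U) 0ℤ 1ℤ (B +ℕ (suc (r ∸ j) +ℕ A))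
      ≡ Φ (suc (s +ℕ j)) (r ∸ j)
    swapped j j≤r bound = trans (expand-swap _ V ((suc (r ∸ j) , a) ∷ U) 0ℤ 1ℤ _)
      (trans (cong (expand _ ((suc (r ∸ j) , a) ∷ U) V 0ℤ -1ℤ) (ℕP.+-comm B _))
             (rest≡Φ j j≤r (subst (_≤ M) (ℕP.+-comm B _) bound)))

  expand≡shuffleSum : ∀ n (U V : HWord G) → length U +ℕ length V ≤ n → Positive U → Positive V →
    weight U +ℕ weight V ≤ M → ∀ f ε → expand f U V 0ℤ ε (weight U +ℕ weight V) ≡ shuffleSum f U V
  expand≡shuffleSum n [] V _ _ V⁺ w≤M f ε = begin
    expand f [] V 0ℤ ε (weight V)      ≡⟨ expand-swap f [] V 0ℤ ε (weight V) ⟩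
    expand f V [] 0ℤ (- ε) (weight V)  ≡⟨ expand-no-surplus f V [] (- ε) 1ℤ (weight V) ⟩
    expand f V [] 0ℤ 1ℤ (weight V)     ≡⟨ expand-single f V 0ℤ V⁺ w≤M ⟩
    f V                                ≡⟨ shuffleSum-[]ˡ f V V⁺ ⟨
    shuffleSum f [] V                  ∎
    where open ≡-Reasoning
  expand≡shuffleSum n U@(_ ∷ _) [] _ U⁺ _ w≤M f ε = begin
    expand f U [] 0ℤ ε (weight U +ℕ 0)  ≡⟨ cong (expand f U [] 0ℤ ε) (ℕP.+-identityʳ (weight U)) ⟩
    expand f U [] 0ℤ ε (weight U)       ≡⟨ expand-no-surplus f U [] ε 1ℤ (weight U) ⟩
    expand f U [] 0ℤ 1ℤ (weight U)      ≡⟨ expand-single f U 0ℤ U⁺ (subst (_≤ M) (ℕP.+-identityʳ _) w≤M) ⟩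
    f U                                 ≡⟨ shuffleSum-[]ʳ f U U⁺ ⟨
    shuffleSum f U []                   ∎
    where open ≡-Reasoning
  expand≡shuffleSum (suc n) ((suc r , a) ∷ U) ((suc s , b) ∷ V) len (_ ∷ U⁺) (_ ∷ V⁺) N≤M f ε =
    trans (cong₂ _+_
      (expandˡ-firstLetter f r a U s b V ε (weight U) (weight V) Φˡ N≤M λ j j≤s bound →
         expand≡shuffleSum n U ((suc (s ∸ j) , b) ∷ V) len′ U⁺ (s≤s z≤n ∷ V⁺) bound _ 1ℤ)
      (expandʳ-firstLetter f r a U s b V ε (weight U) (weight V) Φʳ N≤M λ j j≤r bound →
         expand≡shuffleSum n ((suc (r ∸ j) , a) ∷ U) V (subst (_≤ n) (ℕP.+-suc (length U) (length V)) len′)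
                           (s≤s z≤n ∷ U⁺) V⁺ bound _ -1ℤ))
      (sym (shuffleSum-∷ f r a U s b V))
    where
    Φˡ Φʳ : ℕ → ℕ → ℤ
    Φˡ m h = shuffleSum (f ∘ ((m , a) ∷_)) U ((suc h , b) ∷ V)
    Φʳ m h = shuffleSum (f ∘ ((m , b) ∷_)) ((suc h , a) ∷ U) V
    len′ : length U +ℕ suc (length V) ≤ n
    len′ = ℕP.≤-pred len

-- Shuffle permutations, by their first entry

IsShufflePerm : ℕ → Vec (Fin n) n → Set
IsShufflePerm k σ = IsPerm σ × IsShuffleOrder k σ

-- InS? of the statement, for arbitrary n; for n = k + ℓ the two agree definitionally.
isShufflePerm? : (k : ℕ) (σ : Vec (Fin n) n) → Dec (IsShufflePerm k σ)
isShufflePerm? k σ =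
  (FinP.all? λ i → FinP.all? λ j → (lookup σ i FinP.≟ lookup σ j) →-dec (i FinP.≟ j))
  ×-dec
  (FinP.all? λ i → FinP.all? λ j → (toℕ i <? toℕ j) →-dec
     ((((toℕ (lookup σ i) <? k) →-dec (toℕ (lookup σ j) <? k))
       ×-dec ((toℕ (lookup σ j) <? k) →-dec (toℕ (lookup σ i) <? k)))
      →-dec (toℕ (lookup σ i) <? toℕ (lookup σ j))))

module _ (p : Fin (suc n)) (τ : Vec (Fin n) n) where

  private
    σ : Vec (Fin (suc n)) (suc n)
    σ = p ∷ Vec.map (punchIn p) τ

    σ-suc : ∀ i → lookup σ (suc i) ≡ punchIn p (lookup τ i)
    σ-suc i = VecP.lookup-map i (punchIn p) τ

  isPerm-cons : IsPerm (p ∷ Vec.map (punchIn p) τ) ⇔ IsPerm τ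
  isPerm-cons = mk⇔ to from
    where
    to : IsPerm σ → IsPerm τ
    to perm i j eq = FinP.suc-injective
      (perm (suc i) (suc j) (trans (σ-suc i) (trans (cong (punchIn p) eq) (sym (σ-suc j)))))
    from : IsPerm τ → IsPerm σ
    from perm zero    zero    eq = refl
    from perm zero    (suc j) eq = ⊥-elim (FinP.punchInᵢ≢i p (lookup τ j) (sym (trans eq (σ-suc j))))
    from perm (suc i) zero    eq = ⊥-elim (FinP.punchInᵢ≢i p (lookup τ i) (trans (sym (σ-suc i)) eq))
    from perm (suc i) (suc j) eq = cong suc
      (perm i j (FinP.punchIn-injective p _ _ (trans (sym (σ-suc i)) (trans eq (σ-suc j)))))

  isShuffleOrder-cons : ∀ k k′ → (∀ c → toℕ (punchIn p c) < k ⇔ toℕ c < k′) →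
    (∀ c → SameBlock k p (punchIn p c) → toℕ p < toℕ (punchIn p c)) →
    IsShuffleOrder k (p ∷ Vec.map (punchIn p) τ) ⇔ IsShuffleOrder k′ τ
  isShuffleOrder-cons k k′ blocks first = mk⇔ to from
    where
    inBlock→ : ∀ i → toℕ (lookup σ (suc i)) < k → toℕ (lookup τ i) < k′
    inBlock→ i h = Equivalence.to (blocks (lookup τ i)) (subst (λ z → toℕ z < k) (σ-suc i) h)
    inBlock← : ∀ i → toℕ (lookup τ i) < k′ → toℕ (lookup σ (suc i)) < k
    inBlock← i h = subst (λ z → toℕ z < k) (sym (σ-suc i)) (Equivalence.from (blocks (lookup τ i)) h)
    punchIn-mono-< : ∀ c d → toℕ c < toℕ d → toℕ (punchIn p c) < toℕ (punchIn p d)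
    punchIn-mono-< c d c<d = ℕP.≰⇒> (λ le → ℕP.<⇒≱ c<d (FinP.punchIn-cancel-≤ p d c le))
    punchIn-cancel-< : ∀ c d → toℕ (punchIn p c) < toℕ (punchIn p d) → toℕ c < toℕ d
    punchIn-cancel-< c d lt = ℕP.≰⇒> (λ le → ℕP.<⇒≱ lt (FinP.punchIn-mono-≤ p d c le))
    to : IsShuffleOrder k σ → IsShuffleOrder k′ τ
    to ord i j i<j (f , g) = punchIn-cancel-< (lookup τ i) (lookup τ j)
      (subst₂ (λ c d → toℕ c < toℕ d) (σ-suc i) (σ-suc j)
        (ord (suc i) (suc j) (s≤s i<j) ((λ h → inBlock← j (f (inBlock→ i h))) , (λ h → inBlock← i (g (inBlock→ j h))))))
    from : IsShuffleOrder k′ τ → IsShuffleOrder k σ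
    from ord zero (suc j) _ sb = subst (λ z → toℕ p < toℕ z) (sym (σ-suc j))
      (first (lookup τ j) (subst (SameBlock k p) (σ-suc j) sb))
    from ord (suc i) (suc j) (s≤s i<j) (f , g) = subst₂ (λ c d → toℕ c < toℕ d) (sym (σ-suc i)) (sym (σ-suc j))
      (punchIn-mono-< (lookup τ i) (lookup τ j)
        (ord i j i<j ((λ h → inBlock→ j (f (inBlock← i h))) , (λ h → inBlock→ i (g (inBlock← j h))))))

punchIn-below : (p : Fin (suc n)) (c : Fin n) → toℕ (punchIn p c) < toℕ p ⇔ toℕ c < toℕ p
punchIn-below p c = mk⇔ (to p c) (from p c)
  where
  to : ∀ {n} (p : Fin (suc n)) c → toℕ (punchIn p c) < toℕ p → toℕ c < toℕ p
  to (suc p) zero    _       = s≤s z≤n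
  to (suc p) (suc c) (s≤s h) = s≤s (to p c h)
  from : ∀ {n} (p : Fin (suc n)) c → toℕ c < toℕ p → toℕ (punchIn p c) < toℕ p
  from (suc p) zero    _       = s≤s z≤n
  from (suc p) (suc c) (s≤s h) = s≤s (from p c h)

isShufflePerm-cons-zero : ∀ k (τ : Vec (Fin n) n) →
  IsShufflePerm (suc k) (zero ∷ Vec.map (punchIn zero) τ) ⇔ IsShufflePerm k τ
isShufflePerm-cons-zero k τ = isPerm-cons zero τ ×-⇔
  isShuffleOrder-cons zero τ (suc k) k (λ c → mk⇔ ℕP.≤-pred s≤s) (λ _ _ → s≤s z≤n)

isShufflePerm-cons-at : ∀ k (p : Fin (suc n)) τ → toℕ p ≡ k →
  IsShufflePerm k (p ∷ Vec.map (punchIn p) τ) ⇔ IsShufflePerm k τ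
isShufflePerm-cons-at _ p τ refl = isPerm-cons p τ ×-⇔
  isShuffleOrder-cons p τ (toℕ p) (toℕ p) (punchIn-below p) after
  where
  after : ∀ c → SameBlock (toℕ p) p (punchIn p c) → toℕ p < toℕ (punchIn p c)
  after c (_ , below⇒below) = ℕP.≤∧≢⇒<
    (ℕP.≮⇒≥ (λ h → ℕP.<-irrefl refl (below⇒below h)))
    (λ eq → FinP.punchInᵢ≢i p c (FinP.toℕ-injective (sym eq)))

injective⇒surjective : (σ : Vec (Fin n) n) → IsPerm σ → ∀ c → ∃ λ i → lookup σ i ≡ c
injective⇒surjective {suc n} σ perm c with FinP.any? (λ i → lookup σ i FinP.≟ c)
... | yes hit = hit
... | no miss = ⊥-elim (FinP.<⇒notInjective {f = squeeze} (ℕP.n<1+n n) squeeze-injective)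
  where
  squeeze : Fin (suc n) → Fin n
  squeeze i = punchOut {i = c} {j = lookup σ i} (λ eq → miss (i , sym eq))
  squeeze-injective : ∀ {i j} → squeeze i ≡ squeeze j → i ≡ j
  squeeze-injective {i} {j} eq =
    perm i j (FinP.punchOut-injective (λ e → miss (i , sym e)) (λ e → miss (j , sym e)) eq)

-- Every entry of a block is preceded by the smaller ones of its block, so a shuffle permutation
-- starts with 0 or with k.
shufflePerm-head : ∀ k (p : Fin (suc n)) v → toℕ p ≢ 0 → toℕ p ≢ k → ¬ IsShufflePerm k (p ∷ v)
shufflePerm-head {n} k p v p≢0 p≢k (perm , ord) with ℕP.<-cmp (toℕ p) k
... | tri< p<k _ _ = first-block (injective⇒surjective (p ∷ v) perm zero)
  where
  first-block : ∃ (λ i → lookup (p ∷ v) i ≡ zero) → ⊥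
  first-block (zero , eq)  = p≢0 (cong toℕ eq)
  first-block (suc i , eq) = ℕP.n≮0 (subst (λ z → toℕ p < toℕ z) eq
    (ord zero (suc i) (s≤s z≤n) ((λ _ → subst (λ z → toℕ z < k) (sym eq) (ℕP.≤-trans (s≤s z≤n) p<k)) , (λ _ → p<k))))
... | tri≈ _ p≡k _ = p≢k p≡k
... | tri> _ _ k<p = second-block (injective⇒surjective (p ∷ v) perm c)
  where
  k<n : k < suc n
  k<n = ℕP.<-trans k<p (FinP.toℕ<n p)
  c : Fin (suc n)
  c = fromℕ< k<n
  toℕc≡k : toℕ c ≡ k
  toℕc≡k = FinP.toℕ-fromℕ< k<n
  second-block : ∃ (λ i → lookup (p ∷ v) i ≡ c) → ⊥
  second-block (zero , eq)  = p≢k (trans (cong toℕ eq) toℕc≡k)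
  second-block (suc i , eq) = ℕP.<-asym k<p (subst (toℕ p <_) toℕc≡k (subst (λ z → toℕ p < toℕ z) eq
    (ord zero (suc i) (s≤s z≤n)
      ((λ h → ⊥-elim (ℕP.<-asym k<p h)) , (λ h → ⊥-elim (ℕP.<-irrefl toℕc≡k (subst (λ z → toℕ z < k) eq h)))))))

repeated-head : ∀ (p : Fin (suc n)) v i → lookup v i ≡ p → ¬ IsPerm (p ∷ v)
repeated-head p v i eq perm with perm zero (suc i) (sym eq)
... | ()

sumBy-allVecs-suc : (ys : List A) (m : ℕ) (h : Vec A (suc m) → ℤ) →
  sumBy h (allVecs ys (suc m)) ≡ sumBy (λ c → sumBy (λ v → h (c ∷ v)) (allVecs ys m)) ys
sumBy-allVecs-suc ys m h = trans (sumBy-concatMap h (λ c → map (c ∷_) (allVecs ys m)) ys)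
  (sumBy-cong (λ c → sumBy-map h (c ∷_) (allVecs ys m)) ys)

-- The vectors avoiding p are exactly the punched-in ones.
sumBy-allVecs-avoiding : ∀ m (p : Fin (suc n)) (h : Vec (Fin (suc n)) m → ℤ) →
  (∀ v i → lookup v i ≡ p → h v ≡ 0ℤ) →
  sumBy h (allVecs (allFin (suc n)) m) ≡ sumBy (h ∘ Vec.map (punchIn p)) (allVecs (allFin n) m)
sumBy-allVecs-avoiding zero    p h _ = refl
sumBy-allVecs-avoiding {n} (suc m) p h avoid = begin
  sumBy h (allVecs (allFin (suc n)) (suc m))
    ≡⟨ sumBy-allVecs-suc (allFin (suc n)) m h ⟩
  sumBy H (allFin (suc n))
    ≡⟨ sumBy-tabulate H (λ c → c) ⟩
  sum H
    ≡⟨ sum-remove {i = p} H ⟩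
  H p + sum (H ∘ punchIn p)
    ≡⟨ cong₂ _+_ (sumBy-vanishes (λ v → avoid (p ∷ v) zero refl) (allVecs (allFin (suc n)) m))
                 (sym (sumBy-tabulate (H ∘ punchIn p) (λ c → c))) ⟩
  0ℤ + sumBy (H ∘ punchIn p) (allFin n)
    ≡⟨ ℤP.+-identityˡ _ ⟩
  sumBy (H ∘ punchIn p) (allFin n)
    ≡⟨ sumBy-cong (λ c → sumBy-allVecs-avoiding m p (λ v → h (punchIn p c ∷ v))
                           (λ v i eq → avoid (punchIn p c ∷ v) (suc i) eq)) (allFin n) ⟩
  sumBy (λ c → sumBy (λ τ → h (punchIn p c ∷ Vec.map (punchIn p) τ)) (allVecs (allFin n) m)) (allFin n)
    ≡⟨ sumBy-allVecs-suc (allFin n) m (h ∘ Vec.map (punchIn p)) ⟨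
  sumBy (h ∘ Vec.map (punchIn p)) (allVecs (allFin n) (suc m)) ∎
  where
  open ≡-Reasoning
  H : Fin (suc n) → ℤ
  H c = sumBy (λ v → h (c ∷ v)) (allVecs (allFin (suc n)) m)

sumShuffles : ℕ → (Vec (Fin n) n → ℤ) → ℤ
sumShuffles {n} k F = sumBy (λ σ → when (does (isShufflePerm? k σ)) (F σ)) (allVecs (allFin n) n)

sumShuffles-cong : ∀ k {F F′ : Vec (Fin n) n → ℤ} → (∀ σ → F σ ≡ F′ σ) → sumShuffles k F ≡ sumShuffles k F′
sumShuffles-cong {n} k F≗F′ = sumBy-cong (λ σ → cong (when (does (isShufflePerm? k σ))) (F≗F′ σ)) (allVecs (allFin n) n)

firstInLeft : ℕ → (Vec (Fin (suc n)) (suc n) → ℤ) → ℤ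
firstInLeft zero    F = 0ℤ
firstInLeft (suc k) F = sumShuffles k (λ τ → F (zero ∷ Vec.map (punchIn zero) τ))

firstInRight : (k : ℕ) → Dec (k < suc n) → (Vec (Fin (suc n)) (suc n) → ℤ) → ℤ
firstInRight k (yes k<n) F = sumShuffles k (λ τ → F (fromℕ< k<n ∷ Vec.map (punchIn (fromℕ< k<n)) τ))
firstInRight k (no _)    F = 0ℤ

module _ (k : ℕ) (F : Vec (Fin (suc n)) (suc n) → ℤ) where

  headedBy : Fin (suc n) → ℤ
  headedBy p = sumBy (λ v → when (does (isShufflePerm? k (p ∷ v))) (F (p ∷ v))) (allVecs (allFin (suc n)) n)

  sumShuffles-byHead : sumShuffles k F ≡ headedBy zero + sum (headedBy ∘ suc)
  sumShuffles-byHead = trans (sumBy-allVecs-suc (allFin (suc n)) n (λ σ → when (does (isShufflePerm? k σ)) (F σ)))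
                             (sumBy-tabulate headedBy (λ c → c))

  headedBy-impossible : ∀ p → toℕ p ≢ 0 → toℕ p ≢ k → headedBy p ≡ 0ℤ
  headedBy-impossible p p≢0 p≢k = sumBy-vanishes
    (λ v → cong (λ b → when b (F (p ∷ v))) (dec-false (isShufflePerm? k (p ∷ v)) (shufflePerm-head k p v p≢0 p≢k)))
    (allVecs (allFin (suc n)) n)

  headedBy-removeHead : ∀ p k′ → (∀ τ → IsShufflePerm k (p ∷ Vec.map (punchIn p) τ) ⇔ IsShufflePerm k′ τ) →
    headedBy p ≡ sumShuffles k′ (λ τ → F (p ∷ Vec.map (punchIn p) τ))
  headedBy-removeHead p k′ removeHead = trans
    (sumBy-allVecs-avoiding n p (λ v → when (does (isShufflePerm? k (p ∷ v))) (F (p ∷ v)))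
      λ v i eq → cong (λ b → when b (F (p ∷ v)))
                      (dec-false (isShufflePerm? k (p ∷ v)) (repeated-head p v i eq ∘ proj₁)))
    (sumBy-cong (λ τ → cong (λ b → when b (F (p ∷ Vec.map (punchIn p) τ)))
                  (does-⇔ (removeHead τ) (isShufflePerm? k (p ∷ Vec.map (punchIn p) τ)) (isShufflePerm? k′ τ)))
      (allVecs (allFin n) n))

sumShuffles-suc : ∀ k (F : Vec (Fin (suc n)) (suc n) → ℤ) →
  sumShuffles k F ≡ firstInLeft k F + firstInRight k (k <? suc n) F
sumShuffles-suc {n} zero F with zero <? suc n
... | no 0≮1+n = ⊥-elim (0≮1+n (s≤s z≤n))
... | yes _ = begin
  sumShuffles 0 F
    ≡⟨ sumShuffles-byHead 0 F ⟩
  headedBy 0 F zero + sum (headedBy 0 F ∘ suc)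
    ≡⟨ cong₂ _+_ (headedBy-removeHead 0 F zero 0 (λ τ → isShufflePerm-cons-at 0 zero τ refl))
                 (sum-vanishes (λ c → headedBy-impossible 0 F (suc c) (λ ()) (λ ()))) ⟩
  sumShuffles 0 (λ τ → F (zero ∷ Vec.map (punchIn zero) τ)) + 0ℤ
    ≡⟨ ℤP.+-identityʳ _ ⟩
  sumShuffles 0 (λ τ → F (zero ∷ Vec.map (punchIn zero) τ))
    ≡⟨ ℤP.+-identityˡ _ ⟨
  0ℤ + sumShuffles 0 (λ τ → F (zero ∷ Vec.map (punchIn zero) τ)) ∎
  where open ≡-Reasoning
sumShuffles-suc {n} (suc k) F with suc k <? suc n
... | no k≮n = trans (sumShuffles-byHead (suc k) F) (cong₂ _+_
  (headedBy-removeHead (suc k) F zero k (isShufflePerm-cons-zero k))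
  (sum-vanishes λ c → headedBy-impossible (suc k) F (suc c) (λ ())
     (λ eq → k≮n (s≤s (subst (_< n) (ℕP.suc-injective eq) (FinP.toℕ<n c))))))
sumShuffles-suc {zero}  (suc k) F | yes (s≤s ())
sumShuffles-suc {suc n} (suc k) F | yes k<n = trans (sumShuffles-byHead (suc k) F) (cong₂ _+_
  (headedBy-removeHead (suc k) F zero k (isShufflePerm-cons-zero k))
  (begin
    sum (headedBy (suc k) F ∘ suc)
      ≡⟨ sum-remove {i = q} (headedBy (suc k) F ∘ suc) ⟩
    headedBy (suc k) F (suc q) + sum (headedBy (suc k) F ∘ suc ∘ punchIn q)
      ≡⟨ cong₂ _+_ (headedBy-removeHead (suc k) F (suc q) (suc k)
                     (λ τ → isShufflePerm-cons-at (suc k) (suc q) τ (cong suc toℕq≡k)))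
                   (sum-vanishes λ c → headedBy-impossible (suc k) F (suc (punchIn q c)) (λ ())
                     (λ eq → FinP.punchInᵢ≢i q c (FinP.toℕ-injective (trans (ℕP.suc-injective eq) (sym toℕq≡k))))) ⟩
    firstInRight (suc k) (yes k<n) F + 0ℤ
      ≡⟨ ℤP.+-identityʳ _ ⟩
    firstInRight (suc k) (yes k<n) F ∎))
  where
  open ≡-Reasoning
  q : Fin (suc n)
  q = fromℕ< (ℕP.≤-pred k<n)
  toℕq≡k : toℕ q ≡ k
  toℕq≡k = FinP.toℕ-fromℕ< (ℕP.≤-pred k<n)

sumShuffles-sumBy : ∀ k (ys : List A) (c : A → Bool) (C : A → ℤ) (Z : Vec (Fin n) n → A → ℤ) →
  sumShuffles k (λ τ → sumBy (λ y → when (c y) (C y * Z τ y)) ys) ≡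
  sumBy (λ y → when (c y) (C y * sumShuffles k (λ τ → Z τ y))) ys
sumShuffles-sumBy {n = n} k ys c C Z = begin
  sumBy (λ τ → when (inS τ) (sumBy (λ y → when (c y) (C y * Z τ y)) ys)) σs
    ≡⟨ sumBy-cong (λ τ → when-sumBy (inS τ) (λ y → when (c y) (C y * Z τ y)) ys) σs ⟩
  sumBy (λ τ → sumBy (λ y → when (inS τ) (when (c y) (C y * Z τ y))) ys) σs
    ≡⟨ sumBy-swap (λ τ y → when (inS τ) (when (c y) (C y * Z τ y))) σs ys ⟩
  sumBy (λ y → sumBy (λ τ → when (inS τ) (when (c y) (C y * Z τ y))) σs) ys
    ≡⟨ sumBy-cong (λ y → sumBy-cong (λ τ →
         trans (when-comm (inS τ) (c y) _) (cong (when (c y)) (when-*ʳ (inS τ) (C y) (Z τ y)))) σs) ys ⟩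
  sumBy (λ y → sumBy (λ τ → when (c y) (C y * when (inS τ) (Z τ y))) σs) ys
    ≡⟨ sumBy-cong (λ y → trans (sym (when-sumBy (c y) (λ τ → C y * when (inS τ) (Z τ y)) σs))
                                (cong (when (c y)) (sumBy-*ˡ (C y) (λ τ → when (inS τ) (Z τ y)) σs))) ys ⟩
  sumBy (λ y → when (c y) (C y * sumShuffles k (λ τ → Z τ y))) ys ∎
  where
  open ≡-Reasoning
  σs : List (Vec (Fin n) n)
  σs = allVecs (allFin n) n
  inS : Vec (Fin n) n → Bool
  inS τ = does (isShufflePerm? k τ)

-- The right-hand side, summed over σ and t

blockSign : ℕ → Fin n → ℤ
blockSign k c = if does (toℕ c <? k) then 1ℤ else -1ℤ

binomialProduct : List (ℕ × ℤ × ℕ) → ℤ → ℤ → ℕ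
binomialProduct []                  P ε = 1
binomialProduct ((κ , e , t) ∷ xs) P ε =
  binomℤ (t ∸ 1) (lowerIndex κ e ε P) ℕ.* binomialProduct xs (P + (+ t - + κ)) e

letterData : ℕ → (Fin n → ℕ) → Vec (Fin n) n → Vec ℕ n → List (ℕ × ℤ × ℕ)
letterData k κ σ t = tabulate (λ i → (κ (lookup σ i) , blockSign k (lookup σ i) , lookup t i))

binomialProduct-no-surplus : ∀ xs ε ε′ → binomialProduct xs 0ℤ ε ≡ binomialProduct xs 0ℤ ε′
binomialProduct-no-surplus []                  ε ε′ = refl
binomialProduct-no-surplus ((κ , e , t) ∷ xs) ε ε′ = cong (ℕ._* binomialProduct xs (0ℤ + (+ t - + κ)) e)
  (cong (binomℤ (t ∸ 1)) (trans (lowerIndex-no-surplus κ e ε) (sym (lowerIndex-no-surplus κ e ε′))))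

productℕ-tabulate : (g : A → ℕ) (h : Fin n → A) → productℕ (map g (tabulate h)) ≡ product (g ∘ h)
productℕ-tabulate {n = zero}  g h = refl
productℕ-tabulate {n = suc n} g h = cong (g (h zero) ℕ.*_) (productℕ-tabulate g (h ∘ suc))

prefixSum : (Fin n → ℕ) → (Fin n → ℕ) → Fin n → ℤ
prefixSum κ t i = sum (λ j → when (does (toℕ j <? toℕ i)) (+ t j - + κ j))

previous : ℤ → (Fin n → ℤ) → Fin n → ℤ
previous ε₀ e zero    = ε₀
previous ε₀ e (suc i) = e (Fin.inject₁ i)

product≡binomialProduct : ∀ n (κ : Fin n → ℕ) (e : Fin n → ℤ) (t : Fin n → ℕ) P ε →
  product (λ i → binomℤ (t i ∸ 1) (lowerIndex (κ i) (e i) (previous ε e i) (P + prefixSum κ t i)))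
  ≡ binomialProduct (tabulate (λ i → (κ i , e i , t i))) P ε
product≡binomialProduct zero    κ e t P ε = refl
product≡binomialProduct (suc n) κ e t P ε = cong₂ ℕ._*_
  (cong (λ z → binomℤ (t zero ∸ 1) (lowerIndex (κ zero) (e zero) ε z))
        (trans (cong (_+_ P) (sum-vanishes {n = suc n} (λ _ → refl))) (ℤP.+-identityʳ P)))
  (trans (product-cong tail) (product≡binomialProduct n (κ ∘ suc) (e ∘ suc) (t ∘ suc) (P + (+ t zero - + κ zero)) (e zero)))
  where
  previous-suc : ∀ i → previous ε e (suc i) ≡ previous (e zero) (e ∘ suc) i
  previous-suc zero    = refl
  previous-suc (suc i) = refl
  tail : ∀ i → binomℤ (t (suc i) ∸ 1) (lowerIndex (κ (suc i)) (e (suc i)) (previous ε e (suc i)) (P + prefixSum κ t (suc i)))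
             ≡ binomℤ (t (suc i) ∸ 1) (lowerIndex (κ (suc i)) (e (suc i)) (previous (e zero) (e ∘ suc) i)
                                         (P + (+ t zero - + κ zero) + prefixSum (κ ∘ suc) (t ∘ suc) i))
  tail i = cong₂ (λ ε′ z → binomℤ (t (suc i) ∸ 1) (lowerIndex (κ (suc i)) (e (suc i)) ε′ z))
                 (previous-suc i) (sym (ℤP.+-assoc P (+ t zero - + κ zero) _))

ε≡blockSign : ∀ k ℓ κ σ t (i : Fin (k +ℕ ℓ)) → ε k ℓ κ σ t i ≡ blockSign k (lookup σ i)
ε≡blockSign k ℓ κ σ t i with toℕ (lookup σ i) <? k
... | yes lt = cong (λ c → if c then 1ℤ else -1ℤ) (sym (dec-true (toℕ (lookup σ i) <? k) lt))
... | no ≮  = cong (λ c → if c then 1ℤ else -1ℤ) (sym (dec-false (toℕ (lookup σ i) <? k) ≮))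

coeff≡binomialProduct : ∀ k ℓ (κ : Vec ℕ (suc k +ℕ ℓ)) σ t →
  coeff (suc k) ℓ κ σ t ≡ binomialProduct (letterData (suc k) (lookup κ) σ t) 0ℤ 1ℤ
coeff≡binomialProduct k ℓ κ σ t = begin
  coeff (suc k) ℓ κ σ t
    ≡⟨ productℕ-tabulate (λ i → binomℤ (lookup t i ∸ 1) (lower (suc k) ℓ κ σ t i)) (λ i → i) ⟩
  product (λ i → binomℤ (lookup t i ∸ 1) (lower (suc k) ℓ κ σ t i))
    ≡⟨ product-cong (λ i → cong (binomℤ (lookup t i ∸ 1)) (lower≡ i)) ⟩
  product (λ i → binomℤ (lookup t i ∸ 1) (lowerIndex (κσ i) (e i) (previous (e zero) e i) (0ℤ + prefixSum κσ (lookup t) i)))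
    ≡⟨ product≡binomialProduct _ κσ e (lookup t) 0ℤ (e zero) ⟩
  binomialProduct (letterData (suc k) (lookup κ) σ t) 0ℤ (e zero)
    ≡⟨ binomialProduct-no-surplus (letterData (suc k) (lookup κ) σ t) (e zero) 1ℤ ⟩
  binomialProduct (letterData (suc k) (lookup κ) σ t) 0ℤ 1ℤ ∎
  where
  open ≡-Reasoning
  κσ : Fin (suc k +ℕ ℓ) → ℕ
  κσ i = lookup κ (lookup σ i)
  e : Fin (suc k +ℕ ℓ) → ℤ
  e i = blockSign (suc k) (lookup σ i)
  εprev≡previous : ∀ i → εprev (suc k) ℓ κ σ t i ≡ previous (e zero) e i
  εprev≡previous zero    = ε≡blockSign (suc k) ℓ κ σ t zero
  εprev≡previous (suc i) = ε≡blockSign (suc k) ℓ κ σ t (Fin.inject₁ i)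
  partial≡prefixSum : ∀ i → partial (suc k) ℓ κ σ t i ≡ 0ℤ + prefixSum κσ (lookup t) i
  partial≡prefixSum i = trans (sumBy-filter (λ j → toℕ j <? toℕ i) (λ j → + lookup t j - + κσ j) (allFin (suc k +ℕ ℓ)))
    (trans (sumBy-tabulate (λ j → when (does (toℕ j <? toℕ i)) (+ lookup t j - + κσ j)) (λ j → j))
           (sym (ℤP.+-identityˡ _)))
  lower≡ : ∀ i → lower (suc k) ℓ κ σ t i ≡ lowerIndex (κσ i) (e i) (previous (e zero) e i) (0ℤ + prefixSum κσ (lookup t) i)
  lower≡ i = trans (cong₂ (λ e₁ e₂ → lowerIndex (κσ i) e₁ e₂ (partial (suc k) ℓ κ σ t i))
                          (ε≡blockSign (suc k) ℓ κ σ t i) (εprev≡previous i))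
                   (cong (lowerIndex (κσ i) (e i) (previous (e zero) e i)) (partial≡prefixSum i))

nth : List A → ℕ → Maybe A
nth []       _       = nothing
nth (u ∷ us) zero    = just u
nth (u ∷ us) (suc m) = nth us m

nth-++-< : (us vs ws : List A) (m : ℕ) → m < length us → nth (us ++ vs) m ≡ nth (us ++ ws) m
nth-++-< (u ∷ us) vs ws zero    _          = refl
nth-++-< (u ∷ us) vs ws (suc m) (s≤s m<us) = nth-++-< us vs ws m m<us

nth-++-∷-≥ : (us : List A) (v : A) (vs : List A) (m : ℕ) → length us ≤ m → nth (us ++ v ∷ vs) (suc m) ≡ nth (us ++ vs) m
nth-++-∷-≥ []       v vs m       _          = refl
nth-++-∷-≥ (u ∷ us) v vs (suc m) (s≤s us≤m) = nth-++-∷-≥ us v vs m us≤m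

nth-++-∷ : (us : List A) (v : A) (vs : List A) → nth (us ++ v ∷ vs) (length us) ≡ just v
nth-++-∷ []       v vs = refl
nth-++-∷ (u ∷ us) v vs = nth-++-∷ us v vs

toℕ-punchIn-< : (p : Fin (suc n)) (c : Fin n) → toℕ c < toℕ p → toℕ (punchIn p c) ≡ toℕ c
toℕ-punchIn-< (suc p) zero    _         = refl
toℕ-punchIn-< (suc p) (suc c) (s≤s c<p) = cong suc (toℕ-punchIn-< p c c<p)

toℕ-punchIn-≥ : (p : Fin (suc n)) (c : Fin n) → toℕ p ≤ toℕ c → toℕ (punchIn p c) ≡ suc (toℕ c)
toℕ-punchIn-≥ zero    c       _         = refl
toℕ-punchIn-≥ (suc p) (suc c) (s≤s p≤c) = cong suc (toℕ-punchIn-≥ p c p≤c)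

Enumerates : (n k : ℕ) → (Fin n → ℕ × G) → HWord G → HWord G → Set
Enumerates n k w U V = (k ≡ length U) × (n ≡ length U +ℕ length V) × (∀ i → nth (U ++ V) (toℕ i) ≡ just (w i))

enumerates-left : ∀ {k} (w : Fin (suc n) → ℕ × G) r a U V → Enumerates (suc n) (suc k) w ((r , a) ∷ U) V →
  w zero ≡ (r , a) × Enumerates n k (w ∘ suc) U V
enumerates-left w r a U V (k≡ , n≡ , w≡) =
  sym (just-injective (w≡ zero)) , ℕP.suc-injective k≡ , ℕP.suc-injective n≡ , (λ i → w≡ (suc i))

enumerates-right : ∀ (w : Fin (suc n) → ℕ × G) U s b V (k<n : length U < suc n) →
  Enumerates (suc n) (length U) w U ((s , b) ∷ V) →
  w (fromℕ< k<n) ≡ (s , b) × Enumerates n (length U) (w ∘ punchIn (fromℕ< k<n)) U V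
enumerates-right {n} w U s b V k<n (_ , n≡ , w≡) = head , refl , n≡′ , rest
  where
  p : Fin (suc n)
  p = fromℕ< k<n
  toℕp≡k : toℕ p ≡ length U
  toℕp≡k = FinP.toℕ-fromℕ< k<n
  head : w p ≡ (s , b)
  head = just-injective (trans (sym (w≡ p)) (trans (cong (nth (U ++ (s , b) ∷ V)) toℕp≡k) (nth-++-∷ U (s , b) V)))
  n≡′ : n ≡ length U +ℕ length V
  n≡′ = ℕP.suc-injective (trans n≡ (ℕP.+-suc (length U) (length V)))
  rest : ∀ c → nth (U ++ V) (toℕ c) ≡ just (w (punchIn p c))
  rest c with toℕ c <? length U
  ... | yes c<k = trans (nth-++-< U V ((s , b) ∷ V) (toℕ c) c<k)
    (trans (cong (nth (U ++ (s , b) ∷ V)) (sym (toℕ-punchIn-< p c (subst (toℕ c <_) (sym toℕp≡k) c<k))))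
           (w≡ (punchIn p c)))
  ... | no c≮k = trans (sym (nth-++-∷-≥ U (s , b) V (toℕ c) (ℕP.≮⇒≥ c≮k)))
    (trans (cong (nth (U ++ (s , b) ∷ V)) (sym (toℕ-punchIn-≥ p c (subst (_≤ toℕ c) (sym toℕp≡k) (ℕP.≮⇒≥ c≮k)))))
           (w≡ (punchIn p c)))

module RightHandSide (M : ℕ) where

  open Expansion M

  sumCompositions : (n : ℕ) → ℕ → (Vec ℕ n → ℤ) → ℤ
  sumCompositions zero    N h = when (N ≡ᵇ 0) (h [])
  sumCompositions (suc n) N h = sumBy (λ t → when (t ≤ᵇ N) (sumCompositions n (N ∸ t) (h ∘ (t ∷_)))) weights

  sumCompositions-cong : ∀ n N {h h′ : Vec ℕ n → ℤ} → (∀ t → h t ≡ h′ t) →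
                         sumCompositions n N h ≡ sumCompositions n N h′
  sumCompositions-cong zero    N h≗h′ = cong (when (N ≡ᵇ 0)) (h≗h′ [])
  sumCompositions-cong (suc n) N h≗h′ =
    sumBy-cong (λ t → cong (when (t ≤ᵇ N)) (sumCompositions-cong n (N ∸ t) (λ t′ → h≗h′ (t ∷ t′)))) weights

  sumCompositions-*ˡ : ∀ n N c (h : Vec ℕ n → ℤ) →
                       sumCompositions n N (λ t → c * h t) ≡ c * sumCompositions n N h
  sumCompositions-*ˡ zero    N c h = when-*ʳ (N ≡ᵇ 0) c (h [])
  sumCompositions-*ˡ (suc n) N c h = trans
    (sumBy-cong (λ t → trans (cong (when (t ≤ᵇ N)) (sumCompositions-*ˡ n (N ∸ t) c (h ∘ (t ∷_))))
                             (when-*ʳ (t ≤ᵇ N) c _)) weights)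
    (sumBy-*ˡ c (λ t → when (t ≤ᵇ N) (sumCompositions n (N ∸ t) (h ∘ (t ∷_)))) weights)

  sumBy-compositions : ∀ n N (h : Vec ℕ n → ℤ) →
    sumBy (λ t → when (does (sumℕ t ℕ.≟ N)) (h t)) (allVecs weights n) ≡ sumCompositions n N h
  sumBy-compositions zero    zero    h = ℤP.+-identityʳ _
  sumBy-compositions zero    (suc N) h = refl
  sumBy-compositions (suc n) N       h = trans (sumBy-allVecs-suc weights n _) (sumBy-cong first weights)
    where
    first : ∀ t → sumBy (λ v → when (does (t +ℕ sumℕ v ℕ.≟ N)) (h (t ∷ v))) (allVecs weights n)
                ≡ when (t ≤ᵇ N) (sumCompositions n (N ∸ t) (h ∘ (t ∷_)))
    first t with t ≤ᵇ N in t≤ᵇN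
    ... | true = trans
      (sumBy-cong (λ v → cong (λ c → when c (h (t ∷ v)))
                    (does-⇔ (rest v) (t +ℕ sumℕ v ℕ.≟ N) (sumℕ v ℕ.≟ N ∸ t))) (allVecs weights n))
      (sumBy-compositions n (N ∸ t) (h ∘ (t ∷_)))
      where
      t≤N : t ≤ N
      t≤N = ℕP.≤ᵇ⇒≤ t N (subst T (sym t≤ᵇN) _)
      rest : ∀ v → (t +ℕ sumℕ v ≡ N) ⇔ (sumℕ v ≡ N ∸ t)
      rest v = mk⇔ (λ eq → trans (sym (ℕP.m+n∸m≡n t (sumℕ v))) (cong (_∸ t) eq))
                   (λ eq → trans (cong (t +ℕ_) eq) (ℕP.m+[n∸m]≡n t≤N))
    ... | false = sumBy-vanishes (λ v → cong (λ c → when c (h (t ∷ v)))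
      (dec-false (t +ℕ sumℕ v ℕ.≟ N) λ eq → subst T t≤ᵇN (ℕP.≤⇒≤ᵇ (subst (t ≤_) eq (ℕP.m≤m+n t (sumℕ v))))))
      (allVecs weights n)

  -- The right-hand side for letters w : Fin n → ℕ × G, the first k of them of sign 1, generalised
  -- to a start surplus P and sign ε and a total weight N, and seen by f.
  rhsTerm : (n k : ℕ) → (Fin n → ℕ × G) → ℤ → ℤ → ℕ → (HWord G → ℤ) → Vec (Fin n) n → ℤ
  rhsTerm n k w P ε N f σ = sumCompositions n N λ t →
    + binomialProduct (letterData k (proj₁ ∘ w) σ t) P ε * f (word t (Vec.map (proj₂ ∘ w) σ))

  rhs : (n k : ℕ) → (Fin n → ℕ × G) → ℤ → ℤ → ℕ → (HWord G → ℤ) → ℤ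
  rhs n k w P ε N f = sumShuffles k (rhsTerm n k w P ε N f)

  rhsTerm-cons : ∀ k k′ (w : Fin (suc n) → ℕ × G) P ε N f p τ r a e →
    w p ≡ (r , a) → blockSign k p ≡ e → (∀ c → blockSign k (punchIn p c) ≡ blockSign k′ c) →
    rhsTerm (suc n) k w P ε N f (p ∷ Vec.map (punchIn p) τ) ≡
    sumBy (λ t → when (t ≤ᵇ N) (+ binomℤ (t ∸ 1) (lowerIndex r e ε P) *
                   rhsTerm n k′ (w ∘ punchIn p) (P + (+ t - + r)) e (N ∸ t) (f ∘ ((t , a) ∷_)) τ)) weights
  rhsTerm-cons {n = n} k k′ w P ε N f p τ r a e wₚ sₚ s-punchIn = sumBy-cong (λ t → cong (when (t ≤ᵇ N))
      (trans (sumCompositions-cong n (N ∸ t) (factor t))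
             (sumCompositions-*ˡ n (N ∸ t) (+ binomℤ (t ∸ 1) (lowerIndex r e ε P)) _)))
    weights
    where
    open ≡-Reasoning
    κ : Fin (suc n) → ℕ
    κ = proj₁ ∘ w
    γ : Fin (suc n) → _
    γ = proj₂ ∘ w
    σ : Vec (Fin (suc n)) (suc n)
    σ = p ∷ Vec.map (punchIn p) τ
    κₚ≡r : κ p ≡ r
    κₚ≡r = cong proj₁ wₚ
    letterData-cons : ∀ t t′ → letterData k κ σ (t ∷ t′) ≡ (r , e , t) ∷ letterData k′ (κ ∘ punchIn p) τ t′
    letterData-cons t t′ = cong₂ _∷_ (cong₂ (λ κ₀ e₀ → (κ₀ , e₀ , t)) κₚ≡r sₚ) (ListP.tabulate-cong λ i →
      cong₂ (λ c s → (κ c , s , lookup t′ i)) (VecP.lookup-map i (punchIn p) τ)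
            (trans (cong (blockSign k) (VecP.lookup-map i (punchIn p) τ)) (s-punchIn (lookup τ i))))
    factor : ∀ t t′ →
      + binomialProduct (letterData k κ σ (t ∷ t′)) P ε * f (word (t ∷ t′) (Vec.map γ σ)) ≡
      + binomℤ (t ∸ 1) (lowerIndex r e ε P) * (+ binomialProduct (letterData k′ (κ ∘ punchIn p) τ t′) (P + (+ t - + r)) e
                                                 * f ((t , a) ∷ word t′ (Vec.map (γ ∘ punchIn p) τ)))
    factor t t′ = begin
      + binomialProduct (letterData k κ σ (t ∷ t′)) P ε * f ((t , γ p) ∷ word t′ (Vec.map γ (Vec.map (punchIn p) τ)))
        ≡⟨ cong₂ (λ xs w′ → + binomialProduct xs P ε * f (w′ ∷ word t′ (Vec.map γ (Vec.map (punchIn p) τ))))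
                 (letterData-cons t t′) (cong (t ,_) (cong proj₂ wₚ)) ⟩
      + (c₁ ℕ.* c₂) * f ((t , a) ∷ word t′ (Vec.map γ (Vec.map (punchIn p) τ)))
        ≡⟨ cong (λ v → + (c₁ ℕ.* c₂) * f ((t , a) ∷ word t′ v)) (VecP.map-∘ γ (punchIn p) τ) ⟨
      + (c₁ ℕ.* c₂) * fₜ
        ≡⟨ cong (_* fₜ) (ℤP.pos-* c₁ c₂) ⟩
      + c₁ * + c₂ * fₜ
        ≡⟨ ℤP.*-assoc (+ c₁) (+ c₂) fₜ ⟩
      + c₁ * (+ c₂ * fₜ) ∎
      where
      c₁ c₂ : ℕ
      c₁ = binomℤ (t ∸ 1) (lowerIndex r e ε P)
      c₂ = binomialProduct (letterData k′ (κ ∘ punchIn p) τ t′) (P + (+ t - + r)) e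
      fₜ : ℤ
      fₜ = f ((t , a) ∷ word t′ (Vec.map (γ ∘ punchIn p) τ))

  rhs-firstInLeft : ∀ k (w : Fin (suc n) → ℕ × G) P ε N f r a → w zero ≡ (r , a) →
    firstInLeft (suc k) (rhsTerm (suc n) (suc k) w P ε N f) ≡
    sumBy (λ t → when (t ≤ᵇ N) (+ binomℤ (t ∸ 1) (lowerIndex r 1ℤ ε P) *
                   rhs n k (w ∘ suc) (P + (+ t - + r)) 1ℤ (N ∸ t) (f ∘ ((t , a) ∷_)))) weights
  rhs-firstInLeft {n = n} k w P ε N f r a w₀ = trans
    (sumShuffles-cong k λ τ → rhsTerm-cons (suc k) k w P ε N f zero τ r a 1ℤ w₀ refl (λ _ → refl))
    (sumShuffles-sumBy k weights (λ t → t ≤ᵇ N) (λ t → + binomℤ (t ∸ 1) (lowerIndex r 1ℤ ε P))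
      λ τ t → rhsTerm n k (w ∘ suc) (P + (+ t - + r)) 1ℤ (N ∸ t) (f ∘ ((t , a) ∷_)) τ)

  rhs-firstInRight : ∀ k (k<n : k < suc n) (w : Fin (suc n) → ℕ × G) P ε N f s b → w (fromℕ< k<n) ≡ (s , b) →
    firstInRight k (yes k<n) (rhsTerm (suc n) k w P ε N f) ≡
    sumBy (λ t → when (t ≤ᵇ N) (+ binomℤ (t ∸ 1) (lowerIndex s -1ℤ ε P) *
                   rhs n k (w ∘ punchIn (fromℕ< k<n)) (P + (+ t - + s)) -1ℤ (N ∸ t) (f ∘ ((t , b) ∷_)))) weights
  rhs-firstInRight {n = n} k k<n w P ε N f s b wₚ = trans
    (sumShuffles-cong k λ τ → rhsTerm-cons k k w P ε N f p τ s b -1ℤ wₚ p-sign punchIn-sign)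
    (sumShuffles-sumBy k weights (λ t → t ≤ᵇ N) (λ t → + binomℤ (t ∸ 1) (lowerIndex s -1ℤ ε P))
      λ τ t → rhsTerm n k (w ∘ punchIn p) (P + (+ t - + s)) -1ℤ (N ∸ t) (f ∘ ((t , b) ∷_)) τ)
    where
    p : Fin (suc n)
    p = fromℕ< k<n
    toℕp≡k : toℕ p ≡ k
    toℕp≡k = FinP.toℕ-fromℕ< k<n
    p-sign : blockSign k p ≡ -1ℤ
    p-sign = cong (λ c → if c then 1ℤ else -1ℤ) (dec-false (toℕ p <? k) (ℕP.<-irrefl toℕp≡k))
    punchIn-sign : ∀ c → blockSign k (punchIn p c) ≡ blockSign k c
    punchIn-sign c = cong (λ c → if c then 1ℤ else -1ℤ)
      (does-⇔ (subst (λ m → toℕ (punchIn p c) < m ⇔ toℕ c < m) toℕp≡k (punchIn-below p c))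
              (toℕ (punchIn p c) <? k) (toℕ c <? k))

  firstInLeft≡expandˡ : ∀ k (w : Fin (suc n) → ℕ × G) r a U V P ε N f → w zero ≡ (r , a) →
    (∀ P′ N′ f′ → rhs n k (w ∘ suc) P′ 1ℤ N′ f′ ≡ expand f′ U V P′ 1ℤ N′) →
    firstInLeft (suc k) (rhsTerm (suc n) (suc k) w P ε N f) ≡ expandˡ f r a U V P ε N
  firstInLeft≡expandˡ k w r a U V P ε N f w₀ rhs≡ = trans (rhs-firstInLeft k w P ε N f r a w₀)
    (sumBy-cong (λ t → cong (when (t ≤ᵇ N)) (cong (_*_ (+ binomℤ (t ∸ 1) (lowerIndex r 1ℤ ε P)))
      (rhs≡ (P + (+ t - + r)) (N ∸ t) (f ∘ ((t , a) ∷_))))) weights)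

  firstInRight≡expandʳ : ∀ k (k<n : k < suc n) (w : Fin (suc n) → ℕ × G) U s b V P ε N f → w (fromℕ< k<n) ≡ (s , b) →
    (∀ P′ N′ f′ → rhs n k (w ∘ punchIn (fromℕ< k<n)) P′ -1ℤ N′ f′ ≡ expand f′ U V P′ -1ℤ N′) →
    firstInRight k (yes k<n) (rhsTerm (suc n) k w P ε N f) ≡ expandʳ f U s b V P ε N
  firstInRight≡expandʳ k k<n w U s b V P ε N f wₚ rhs≡ = trans (rhs-firstInRight k k<n w P ε N f s b wₚ)
    (sumBy-cong (λ t → cong (when (t ≤ᵇ N)) (cong (_*_ (+ binomℤ (t ∸ 1) (lowerIndex s -1ℤ ε P)))
      (rhs≡ (P + (+ t - + s)) (N ∸ t) (f ∘ ((t , b) ∷_))))) weights)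

  rhs≡expand : ∀ n k (w : Fin n → ℕ × G) U V → Enumerates n k w U V →
    ∀ P ε N f → rhs n k w P ε N f ≡ expand f U V P ε N
  rhs≡expand zero k w [] [] _ P ε N f = trans (ℤP.+-identityʳ _)
    (trans (cong (λ c → when c (when (N ≡ᵇ 0) (+ 1 * f []))) (dec-true (isShufflePerm? k []) ((λ ()) , (λ ()))))
           (cong (when (N ≡ᵇ 0)) (ℤP.*-identityˡ (f []))))
  rhs≡expand (suc n) k w ((r , a) ∷ U) [] enum@(refl , n≡ , _) P ε N f = begin
    rhs (suc n) k w P ε N f
      ≡⟨ sumShuffles-suc k (rhsTerm (suc n) k w P ε N f) ⟩
    firstInLeft k (rhsTerm (suc n) k w P ε N f) + firstInRight k (k <? suc n) (rhsTerm (suc n) k w P ε N f)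
      ≡⟨ cong₂ _+_ (firstInLeft≡expandˡ (length U) w r a U [] P ε N f w₀
                     (λ P′ N′ f′ → rhs≡expand n (length U) (w ∘ suc) U [] enum′ P′ 1ℤ N′ f′))
                   none ⟩
    expandˡ f r a U [] P ε N + 0ℤ
      ≡⟨ ℤP.+-identityʳ _ ⟩
    expandˡ f r a U [] P ε N ∎
    where
    open ≡-Reasoning
    w₀ : w zero ≡ (r , a)
    w₀ = proj₁ (enumerates-left w r a U [] enum)
    enum′ : Enumerates n (length U) (w ∘ suc) U []
    enum′ = proj₂ (enumerates-left w r a U [] enum)
    none : firstInRight k (k <? suc n) (rhsTerm (suc n) k w P ε N f) ≡ 0ℤ
    none with k <? suc n
    ... | no _   = refl
    ... | yes k<n = ⊥-elim (ℕP.<-irrefl (sym (trans n≡ (ℕP.+-identityʳ (suc (length U))))) k<n)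
  rhs≡expand (suc n) k w [] ((s , b) ∷ V) enum@(refl , _ , _) P ε N f = begin
    rhs (suc n) 0 w P ε N f
      ≡⟨ sumShuffles-suc 0 (rhsTerm (suc n) 0 w P ε N f) ⟩
    0ℤ + firstInRight 0 (0 <? suc n) (rhsTerm (suc n) 0 w P ε N f)
      ≡⟨ ℤP.+-identityˡ _ ⟩
    firstInRight 0 (0 <? suc n) (rhsTerm (suc n) 0 w P ε N f)
      ≡⟨ right (0 <? suc n) ⟩
    expandʳ f [] s b V P ε N ∎
    where
    open ≡-Reasoning
    right : (d : Dec (0 < suc n)) → firstInRight 0 d (rhsTerm (suc n) 0 w P ε N f) ≡ expandʳ f [] s b V P ε N
    right (no 0≮1+n) = ⊥-elim (0≮1+n (s≤s z≤n))
    right (yes 0<1+n) = firstInRight≡expandʳ 0 0<1+n w [] s b V P ε N f (proj₁ enum′)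
      (λ P′ N′ f′ → rhs≡expand n 0 (w ∘ punchIn (fromℕ< 0<1+n)) [] V (proj₂ enum′) P′ -1ℤ N′ f′)
      where
      enum′ : w (fromℕ< 0<1+n) ≡ (s , b) × Enumerates n 0 (w ∘ punchIn (fromℕ< 0<1+n)) [] V
      enum′ = enumerates-right w [] s b V 0<1+n enum
  rhs≡expand (suc n) k w ((r , a) ∷ U) ((s , b) ∷ V) enum@(refl , n≡ , w≡) P ε N f = begin
    rhs (suc n) k w P ε N f
      ≡⟨ sumShuffles-suc k (rhsTerm (suc n) k w P ε N f) ⟩
    firstInLeft k (rhsTerm (suc n) k w P ε N f) + firstInRight k (k <? suc n) (rhsTerm (suc n) k w P ε N f)
      ≡⟨ cong₂ _+_ (firstInLeft≡expandˡ (length U) w r a U ((s , b) ∷ V) P ε N f (proj₁ left)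
                     (λ P′ N′ f′ → rhs≡expand n (length U) (w ∘ suc) U ((s , b) ∷ V) (proj₂ left) P′ 1ℤ N′ f′))
                   (right (k <? suc n)) ⟩
    expandˡ f r a U ((s , b) ∷ V) P ε N + expandʳ f ((r , a) ∷ U) s b V P ε N ∎
    where
    open ≡-Reasoning
    left : w zero ≡ (r , a) × Enumerates n (length U) (w ∘ suc) U ((s , b) ∷ V)
    left = enumerates-left w r a U ((s , b) ∷ V) enum
    right : (d : Dec (k < suc n)) → firstInRight k d (rhsTerm (suc n) k w P ε N f) ≡ expandʳ f ((r , a) ∷ U) s b V P ε N
    right (no k≮n) = ⊥-elim (k≮n (s≤s (subst (suc (length U) ≤_)
      (sym (trans (ℕP.suc-injective n≡) (ℕP.+-suc (length U) (length V)))) (s≤s (ℕP.m≤m+n (length U) (length V))))))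
    right (yes k<n) = firstInRight≡expandʳ k k<n w ((r , a) ∷ U) s b V P ε N f (proj₁ enum′)
      (λ P′ N′ f′ → rhs≡expand n k (w ∘ punchIn (fromℕ< k<n)) ((r , a) ∷ U) V (proj₂ enum′) P′ -1ℤ N′ f′)
      where
      enum′ : w (fromℕ< k<n) ≡ (s , b) × Enumerates n k (w ∘ punchIn (fromℕ< k<n)) ((r , a) ∷ U) V
      enum′ = enumerates-right w ((r , a) ∷ U) s b V k<n enum

evalF-⧢ρ : (f : HWord G → ℤ) (U V : HWord G) → evalF f (U ⧢ρ V) ≡ shuffleSum f U V
evalF-⧢ρ f U V = trans (sumBy-map (λ p → proj₁ p * f (proj₂ p)) (λ w → (1ℤ , ρ w)) (shuffle (ρ⁻¹ U) (ρ⁻¹ V)))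
                       (sumBy-cong (λ w → ℤP.*-identityˡ (f (ρ w))) (shuffle (ρ⁻¹ U) (ρ⁻¹ V)))

weight-word : (r : Vec ℕ n) (a : Vec G n) → weight (word r a) ≡ sumℕ r
weight-word []       []      = refl
weight-word (r₀ ∷ r) (_ ∷ a) = cong (r₀ +ℕ_) (weight-word r a)

length-word : (r : Vec ℕ n) (a : Vec G n) → length (word r a) ≡ n
length-word []      []      = refl
length-word (_ ∷ r) (_ ∷ a) = cong suc (length-word r a)

positive-word : (r : Vec ℕ n) (a : Vec G n) → All (1 ≤_) r → Positive (word r a)
positive-word []      []      []         = []
positive-word (_ ∷ r) (_ ∷ a) (r₀⁺ ∷ r⁺) = r₀⁺ ∷ positive-word r a r⁺

word-++ : ∀ {m} (r : Vec ℕ n) (a : Vec G n) (s : Vec ℕ m) (b : Vec G m) →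
  word r a ++ word s b ≡ word (r Vec.++ s) (a Vec.++ b)
word-++ []       []       s b = refl
word-++ (r₀ ∷ r) (a₀ ∷ a) s b = cong ((r₀ , a₀) ∷_) (word-++ r a s b)

nth-word : (r : Vec ℕ n) (a : Vec G n) (i : Fin n) → nth (word r a) (toℕ i) ≡ just (lookup r i , lookup a i)
nth-word (_ ∷ r) (_ ∷ a) zero    = refl
nth-word (_ ∷ r) (_ ∷ a) (suc i) = nth-word r a i

enumerates-word : ∀ {k ℓ} (r : Vec ℕ k) (a : Vec G k) (s : Vec ℕ ℓ) (b : Vec G ℓ) →
  Enumerates (k +ℕ ℓ) k (λ i → lookup (r Vec.++ s) i , lookup (a Vec.++ b) i) (word r a) (word s b)
enumerates-word r a s b =
  sym (length-word r a) , cong₂ _+ℕ_ (sym (length-word r a)) (sym (length-word s b)) ,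
  λ i → trans (cong (λ w → nth w (toℕ i)) (word-++ r a s b)) (nth-word (r Vec.++ s) (a Vec.++ b) i)

evalF-RHS : ∀ k ℓ (r : Vec ℕ (suc k)) (a : Vec G (suc k)) (s : Vec ℕ ℓ) (b : Vec G ℓ) (f : HWord G → ℤ) →
  evalF f (RHS (suc k) ℓ r a s b) ≡
  RightHandSide.rhs (sumℕ r +ℕ sumℕ s) (suc k +ℕ ℓ) (suc k)
    (λ i → lookup (r Vec.++ s) i , lookup (a Vec.++ b) i) 0ℤ 1ℤ (sumℕ r +ℕ sumℕ s) f
evalF-RHS k ℓ r a s b f = begin
  sumBy g (concatMap (λ σ → map (entry σ) (Comps m N)) (S (suc k) ℓ))
    ≡⟨ sumBy-concatMap g (λ σ → map (entry σ) (Comps m N)) (S (suc k) ℓ) ⟩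
  sumBy (λ σ → sumBy g (map (entry σ) (Comps m N))) (S (suc k) ℓ)
    ≡⟨ sumBy-cong (λ σ → sumBy-map g (entry σ) (Comps m N)) (S (suc k) ℓ) ⟩
  sumBy (λ σ → sumBy (g ∘ entry σ) (Comps m N)) (S (suc k) ℓ)
    ≡⟨ sumBy-filter (InS? (suc k) ℓ) (λ σ → sumBy (g ∘ entry σ) (Comps m N)) (allVecs (allFin m) m) ⟩
  sumShuffles (suc k) (λ σ → sumBy (g ∘ entry σ) (Comps m N))
    ≡⟨ sumShuffles-cong (suc k) term ⟩
  rhs m (suc k) w 0ℤ 1ℤ N f ∎
  where
  open ≡-Reasoning
  m N : ℕ
  m = suc k +ℕ ℓ
  N = sumℕ r +ℕ sumℕ s
  κ : Vec ℕ m
  κ = r Vec.++ s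
  γ : Vec _ m
  γ = a Vec.++ b
  w : Fin m → ℕ × _
  w i = lookup κ i , lookup γ i
  open Expansion N using (weights)
  open RightHandSide N
  g : ℤ × HWord _ → ℤ
  g (c , u) = c * f u
  entry : Vec (Fin m) m → Vec ℕ m → ℤ × HWord _
  entry σ t = + coeff (suc k) ℓ κ σ t , word t (Vec.map (lookup γ) σ)
  term : ∀ σ → sumBy (g ∘ entry σ) (Comps m N) ≡ rhsTerm m (suc k) w 0ℤ 1ℤ N f σ
  term σ = trans (sumBy-filter (λ t → sumℕ t ℕ.≟ N) (g ∘ entry σ) (allVecs weights m))
    (trans (sumBy-compositions m N (g ∘ entry σ))
           (sumCompositions-cong m N λ t → cong (λ c → + c * f (word t (Vec.map (lookup γ) σ)))
                                                 (coeff≡binomialProduct k ℓ κ σ t)))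

theorem5p1 : (G : Set) (k ℓ : ℕ) → 1 ≤ k → 1 ≤ ℓ →
    (r : Vec ℕ k) → All (1 ≤_) r → (a : Vec G k) →
    (s : Vec ℕ ℓ) → All (1 ≤_) s → (b : Vec G ℓ) →
    (word r a ⧢ρ word s b) ≈F RHS k ℓ r a s b
theorem5p1 G (suc k) ℓ _ _ r r⁺ a s s⁺ b f = begin
  evalF f (U ⧢ρ V)                                ≡⟨ evalF-⧢ρ f U V ⟩
  shuffleSum f U V                                ≡⟨ expand≡shuffleSum _ U V ℕP.≤-refl U⁺ V⁺ (ℕP.≤-reflexive weight≡) f 1ℤ ⟨
  expand f U V 0ℤ 1ℤ (weight U +ℕ weight V)       ≡⟨ cong (expand f U V 0ℤ 1ℤ) weight≡ ⟩
  expand f U V 0ℤ 1ℤ N                            ≡⟨ rhs≡expand _ (suc k) w U V (enumerates-word r a s b) 0ℤ 1ℤ N f ⟨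
  rhs (suc k +ℕ ℓ) (suc k) w 0ℤ 1ℤ N f            ≡⟨ evalF-RHS k ℓ r a s b f ⟨
  evalF f (RHS (suc k) ℓ r a s b)                 ∎
  where
  open ≡-Reasoning
  U V : HWord G
  U = word r a
  V = word s b
  N : ℕ
  N = sumℕ r +ℕ sumℕ s
  open Expansion N
  open RightHandSide N
  w : Fin (suc k +ℕ ℓ) → ℕ × G
  w i = lookup (r Vec.++ s) i , lookup (a Vec.++ b) i
  U⁺ : Positive U
  U⁺ = positive-word r a r⁺
  V⁺ : Positive V
  V⁺ = positive-word s b s⁺
  weight≡ : weight U +ℕ weight V ≡ N
  weight≡ = cong₂ _+ℕ_ (weight-word r a) (weight-word s b)
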